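{- Let $a,b,q$ be indeterminates and define the $q$-Narayana polynomials $C_n(a,b,q)$ by $C_0(a,b,q)=1$ and, for $n\ge 1$, $$C_n(a,b,q)=a\,C_{n-1}(a,b,q)+b\sum_{k=0}^{n-1}q^k C_k(a,b,q)\,C_{n-k-1}(a,b,q).$$ Then for every $n\ge 0$, $$\det\big(C_{i+j}(a,b,q)\big)_{i,j=0}^{n}=q^{\frac{n^2(n+1)}{2}}\,b^{\binom{n+1}{2}}\prod_{k=0}^{n-1}(a+q^k b)^{\,n-k}$$ and $$\det\big(C_{i+j+1}(a,b,q)\big)_{i,j=0}^{n}=q^{\frac{n(n+1)^2}{2}}\,b^{\binom{n+1}{2}}\prod_{k=0}^{n}(a+q^k b)^{\,n+1-k}.$$
   Context: Equivalently, $f(z,a,b,q)=\sum_{n\ge0}C_n(a,b,q)z^n$ is the unique formal power series with $f(z,a,b,q)=1+azf(z,a,b,q)+bzf(z,a,b,q)f(qz,a,b,q)$. The first values are $1,\ a+b,\ a^2+(2+q)ab+(1+q)b^2,\dots$; for $(a,b)=(0,1)$ these are the Carlitz–Riordan $q$-Catalan numbers. -}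

module Defs where

open import Level using (Level)
open import Algebra.Bundles using (CommutativeRing)
open import Data.Nat using (ℕ; zero; suc)
open import Data.Fin using (Fin; zero; suc; toℕ; fromℕ; punchIn; opposite)

-- All definitions are over an arbitrary commutative ring R; a polynomial
-- identity in the indeterminates a, b, q holds in ℤ[a,b,q] iff it holds for
-- all elements a, b, q of all commutative rings.
module Narayana {c ℓ : Level} (R : CommutativeRing c ℓ) where
  open CommutativeRing R using (Carrier; _+_; _*_; -_; 0#; 1#)

  pow : Carrier → ℕ → Carrier
  pow x zero    = 1#
  pow x (suc n) = x * pow x n

  sumF : (n : ℕ) → (Fin n → Carrier) → Carrier
  sumF zero    f = 0#
  sumF (suc n) f = f zero + sumF n (λ i → f (suc i))

  prodN : ℕ → (ℕ → Carrier) → Carrier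
  prodN zero    f = 1#
  prodN (suc n) f = prodN n f * f n

  snoc : (n : ℕ) → (Fin (suc n) → Carrier) → Carrier → Fin (suc (suc n)) → Carrier
  snoc zero    t x zero    = t zero
  snoc zero    t x (suc _) = x
  snoc (suc n) t x zero    = t zero
  snoc (suc n) t x (suc i) = snoc n (λ j → t (suc j)) x i

  table : Carrier → Carrier → Carrier → (n : ℕ) → Fin (suc n) → Carrier
  table a b q zero    = λ _ → 1#
  table a b q (suc m) =
    snoc m t (a * t (fromℕ m)
              + b * sumF (suc m) (λ k → pow q (toℕ k) * t k * t (opposite k)))
    where
    t : Fin (suc m) → Carrier
    t = table a b q m

  C : Carrier → Carrier → Carrier → ℕ → Carrier
  C a b q n = table a b q n (fromℕ n)

  det : (n : ℕ) → (Fin n → Fin n → Carrier) → Carrier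
  det zero    M = 1#
  det (suc n) M =
    sumF (suc n) (λ j → pow (- 1#) (toℕ j) * M zero j
                        * det n (λ i k → M (suc i) (punchIn j k)))

{-# OPTIONS --safe #-}
module Submission where

-- Let F = Σ Cₙ zⁿ, so that F = 1 + z (a + b F(qz)) F, and F(qz) is the series F for (qa, qb).
-- If a series satisfies X = x₀ + z h X, adding to each column of the Hankel matrix (X_{i+j}) suitable
-- multiples of the earlier columns turns it into T·(1 ⊕ (h_{i+j+1})) with T lower triangular Toeplitz, so
-- det (X_{i+j})_{i,j≤n} = x₀^{n+1} det (h_{i+j+1})_{i,j<n}. To avoid proving multiplicativity of det,
-- this is shown for L·(X_{i+j}) with L lower triangular, whose diagonal product appears as a factor.
-- For X = F this reduces det (C_{i+j}) at (a, b) to bⁿ det (C_{i+j+1}) at (qa, qb). For X = tail F,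
-- the identity (a + b F(qz)) F = (a + b F) E, where E is the series F for (a, qb), gives
-- tail F = (a + b) + z ((a + b) + qb E(qz)) tail F, which reduces det (C_{i+j+1}) at (a, b) to
-- (a + b)^{n+1} (qb)ⁿ det (C_{i+j+1}) at (qa, q²b). The closed forms satisfy the same recursions.

open import Defs
open import Level using (Level; _⊔_)
open import Algebra.Bundles using (CommutativeRing; CommutativeSemiring)
open import Data.Nat using (ℕ; zero; suc; _≤_; _<_; z≤n; s≤s; _∸_; _<?_; _≤?_)
  renaming (_+_ to _+ℕ_; _*_ to _*ℕ_)
import Data.Nat as ℕ
import Data.Nat.Properties as ℕ
open import Data.Nat.DivMod using (_/_; m*n/n≡m)
open import Data.Nat.Combinatorics using (_C_; nC1≡n; nCk+nC[k+1]≡[n+1]C[k+1])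
open import Data.Fin using (Fin; zero; suc; toℕ; fromℕ; fromℕ<; inject₁; punchIn; punchOut; opposite; _≟_)
import Data.Fin.Properties as Fin
import Data.Fin.Permutation as Permutation
open import Data.Product using (_×_; _,_; Σ)
open import Data.Sum using (_⊎_; inj₁; inj₂)
open import Data.Empty using (⊥-elim)
open import Relation.Nullary using (¬_; yes; no)
open import Relation.Binary.PropositionalEquality as ≡ using (_≡_; _≢_)
import Algebra.Properties.Ring as RingProperties
import Algebra.Properties.Semiring.Exp as SemiringExp
import Algebra.Properties.CommutativeSemiring.Exp as CommutativeSemiringExp
import Algebra.Properties.Semiring.Sum as SemiringSum
import Algebra.Solver.Ring.NaturalCoefficients.Default as Solver

module TriangularNumbers where
  open import Data.Nat.Solver using (module +-*-Solver)
  open +-*-Solver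
  open ≡.≡-Reasoning

  tri : ℕ → ℕ
  tri n = suc n C 2

  tri-suc : ∀ n → tri (suc n) ≡ suc n +ℕ tri n
  tri-suc n = ≡.trans (≡.sym (nCk+nC[k+1]≡[n+1]C[k+1] (suc n) 1)) (≡.cong (_+ℕ tri n) (nC1≡n (suc n)))

  tri*2 : ∀ n → tri n *ℕ 2 ≡ suc n *ℕ n
  tri*2 zero    = ≡.refl
  tri*2 (suc n) = begin
    tri (suc n) *ℕ 2          ≡⟨ ≡.cong (_*ℕ 2) (tri-suc n) ⟩
    (suc n +ℕ tri n) *ℕ 2     ≡⟨ ℕ.*-distribʳ-+ 2 (suc n) (tri n) ⟩
    suc n *ℕ 2 +ℕ tri n *ℕ 2  ≡⟨ ≡.cong (suc n *ℕ 2 +ℕ_) (tri*2 n) ⟩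
    suc n *ℕ 2 +ℕ suc n *ℕ n  ≡⟨ solve 1 (λ n → (con 1 :+ n) :* con 2 :+ (con 1 :+ n) :* n
                                            := (con 2 :+ n) :* (con 1 :+ n)) ≡.refl n ⟩
    suc (suc n) *ℕ suc n      ∎

  tri-exponent₀ : ∀ m → tri (suc m) *ℕ suc m ≡ tri m *ℕ suc m +ℕ (tri m +ℕ tri (suc m))
  tri-exponent₀ m rewrite tri-suc m = begin
    (suc m +ℕ t) *ℕ suc m                    ≡⟨ solve 2 (λ m t → (con 1 :+ m :+ t) :* (con 1 :+ m)
                                                          := t :* (con 1 :+ m) :+ ((con 1 :+ m) :* m :+ (con 1 :+ m))) ≡.refl m t ⟩
    t *ℕ suc m +ℕ (suc m *ℕ m +ℕ suc m)      ≡⟨ ≡.cong (λ x → t *ℕ suc m +ℕ (x +ℕ suc m)) (tri*2 m) ⟨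
    t *ℕ suc m +ℕ (t *ℕ 2 +ℕ suc m)          ≡⟨ solve 2 (λ m t → t :* (con 1 :+ m) :+ (t :* con 2 :+ (con 1 :+ m))
                                                          := t :* (con 1 :+ m) :+ (t :+ (con 1 :+ m :+ t))) ≡.refl m t ⟩
    t *ℕ suc m +ℕ (t +ℕ (suc m +ℕ t))        ∎
    where
    t : ℕ
    t = tri m

  tri-exponent₁ : ∀ m → tri (suc m) *ℕ suc (suc m) ≡ suc m +ℕ (tri m *ℕ suc m +ℕ (tri m +ℕ (tri m +ℕ tri (suc m))))
  tri-exponent₁ m rewrite tri-suc m = begin
    (suc m +ℕ t) *ℕ suc (suc m)                          ≡⟨ solve 2 (λ m t → (con 1 :+ m :+ t) :* (con 2 :+ m)
                                                              := t :* (con 2 :+ m) :+ con 2 :* (con 1 :+ m) :+ (con 1 :+ m) :* m) ≡.refl m t ⟩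
    t *ℕ suc (suc m) +ℕ 2 *ℕ suc m +ℕ suc m *ℕ m         ≡⟨ ≡.cong (t *ℕ suc (suc m) +ℕ 2 *ℕ suc m +ℕ_) (tri*2 m) ⟨
    t *ℕ suc (suc m) +ℕ 2 *ℕ suc m +ℕ t *ℕ 2             ≡⟨ solve 2 (λ m t → t :* (con 2 :+ m) :+ con 2 :* (con 1 :+ m) :+ t :* con 2
                                                              := con 1 :+ m :+ (t :* (con 1 :+ m) :+ (t :+ (t :+ (con 1 :+ m :+ t))))) ≡.refl m t ⟩
    suc m +ℕ (t *ℕ suc m +ℕ (t +ℕ (t +ℕ (suc m +ℕ t))))  ∎
    where
    t : ℕ
    t = tri m

  half-of-double : ∀ {m k} → m ≡ k *ℕ 2 → m / 2 ≡ k
  half-of-double {k = k} ≡.refl = m*n/n≡m k 2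

  n²[n+1]/2≡tri*n : ∀ n → (n *ℕ n *ℕ suc n) / 2 ≡ tri n *ℕ n
  n²[n+1]/2≡tri*n n = half-of-double (begin
    n *ℕ n *ℕ suc n      ≡⟨ solve 1 (λ n → n :* n :* (con 1 :+ n) := (con 1 :+ n) :* n :* n) ≡.refl n ⟩
    suc n *ℕ n *ℕ n      ≡⟨ ≡.cong (_*ℕ n) (tri*2 n) ⟨
    tri n *ℕ 2 *ℕ n      ≡⟨ solve 2 (λ t n → t :* con 2 :* n := t :* n :* con 2) ≡.refl (tri n) n ⟩
    tri n *ℕ n *ℕ 2      ∎)

  n[n+1]²/2≡tri*[n+1] : ∀ n → (n *ℕ suc n *ℕ suc n) / 2 ≡ tri n *ℕ suc n
  n[n+1]²/2≡tri*[n+1] n = half-of-double (begin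
    n *ℕ suc n *ℕ suc n  ≡⟨ solve 1 (λ n → n :* (con 1 :+ n) :* (con 1 :+ n) := (con 1 :+ n) :* n :* (con 1 :+ n)) ≡.refl n ⟩
    suc n *ℕ n *ℕ suc n  ≡⟨ ≡.cong (_*ℕ suc n) (tri*2 n) ⟨
    tri n *ℕ 2 *ℕ suc n  ≡⟨ solve 2 (λ t n → t :* con 2 :* n := t :* n :* con 2) ≡.refl (tri n) (suc n) ⟩
    tri n *ℕ suc n *ℕ 2  ∎)

module QNarayanaHankel {c ℓ : Level} (R : CommutativeRing c ℓ) where
  open CommutativeRing R hiding (zero)
  open Narayana R renaming (C to Cₙ)
  open RingProperties ring using (-1*x≈-x; -0#≈0#; +-cancelʳ; +-inverseˡ-unique)
  open SemiringExp semiring using (_^_; ^-homo-*; ^-congˡ)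
  open CommutativeSemiringExp commutativeSemiring using (^-distrib-*)
  open SemiringSum semiring using (sum; sum-cong-≋; sum-cong-≗; ∑-distrib-+; *-distribˡ-sum; sum-replicate-zero; ∑-permute)
  open Solver commutativeSemiring using (solve; _:+_; _:*_; _:=_; con)
  open import Relation.Binary.Reasoning.Setoid setoid
  open TriangularNumbers

  -- Finite sums and products

  sumF≡sum : ∀ n (f : Fin n → Carrier) → sumF n f ≡ sum f
  sumF≡sum zero    f = ≡.refl
  sumF≡sum (suc n) f = ≡.cong (f zero +_) (sumF≡sum n (λ i → f (suc i)))

  sum-zero : ∀ n {f : Fin n → Carrier} → (∀ i → f i ≈ 0#) → sum f ≈ 0#
  sum-zero n f≈0 = trans (sum-cong-≋ f≈0) (sum-replicate-zero n)

  sumN : ℕ → (ℕ → Carrier) → Carrier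
  sumN zero    f = 0#
  sumN (suc n) f = f 0 + sumN n (λ i → f (suc i))

  sumN≡sum : ∀ n (f : ℕ → Carrier) → sumN n f ≡ sum (λ (i : Fin n) → f (toℕ i))
  sumN≡sum zero    f = ≡.refl
  sumN≡sum (suc n) f = ≡.cong (f 0 +_) (sumN≡sum n (λ i → f (suc i)))

  sumN-cong : ∀ n {f g : ℕ → Carrier} → (∀ i → i < n → f i ≈ g i) → sumN n f ≈ sumN n g
  sumN-cong zero    e = refl
  sumN-cong (suc n) e = +-cong (e 0 (s≤s z≤n)) (sumN-cong n (λ i i<n → e (suc i) (s≤s i<n)))

  sumN-zero : ∀ n {f : ℕ → Carrier} → (∀ i → i < n → f i ≈ 0#) → sumN n f ≈ 0#
  sumN-zero zero    f≈0 = refl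
  sumN-zero (suc n) f≈0 = trans (+-cong (f≈0 0 (s≤s z≤n)) (sumN-zero n (λ i i<n → f≈0 (suc i) (s≤s i<n)))) (+-identityʳ 0#)

  sumN-+ : ∀ n (f g : ℕ → Carrier) → sumN n (λ i → f i + g i) ≈ sumN n f + sumN n g
  sumN-+ zero    f g = sym (+-identityʳ 0#)
  sumN-+ (suc n) f g = trans (+-congˡ (sumN-+ n _ _)) (solve 4 (λ a b c d → (a :+ b) :+ (c :+ d) := (a :+ c) :+ (b :+ d)) refl _ _ _ _)

  sumN-*ˡ : ∀ n x (f : ℕ → Carrier) → sumN n (λ i → x * f i) ≈ x * sumN n f
  sumN-*ˡ zero    x f = sym (zeroʳ x)
  sumN-*ˡ (suc n) x f = trans (+-congˡ (sumN-*ˡ n x _)) (sym (distribˡ x _ _))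

  sumN-swap : ∀ m n (f : ℕ → ℕ → Carrier) → sumN m (λ i → sumN n (f i)) ≈ sumN n (λ j → sumN m (λ i → f i j))
  sumN-swap zero    n f = sym (sumN-zero n (λ _ _ → refl))
  sumN-swap (suc m) n f = trans (+-congˡ (sumN-swap m n (λ i → f (suc i)))) (sym (sumN-+ n _ _))

  sumN-last : ∀ n (f : ℕ → Carrier) → sumN (suc n) f ≈ sumN n f + f n
  sumN-last zero    f = trans (+-identityʳ _) (sym (+-identityˡ _))
  sumN-last (suc n) f = trans (+-congˡ (sumN-last n (λ i → f (suc i)))) (sym (+-assoc _ _ _))

  sumN-split : ∀ m n (f : ℕ → Carrier) → sumN (m +ℕ n) f ≈ sumN m f + sumN n (λ i → f (m +ℕ i))
  sumN-split zero    n f = sym (+-identityˡ _)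
  sumN-split (suc m) n f = trans (+-congˡ (sumN-split m n (λ i → f (suc i)))) (sym (+-assoc _ _ _))

  sumN-truncate : ∀ {k n} (f : ℕ → Carrier) → k ≤ n → (∀ l → k ≤ l → f l ≈ 0#) → sumN n f ≈ sumN k f
  sumN-truncate {k} {n} f k≤n late = begin
    sumN n f                                         ≡⟨ ≡.cong (λ m → sumN m f) (ℕ.m+[n∸m]≡n k≤n) ⟨
    sumN (k +ℕ (n ∸ k)) f                            ≈⟨ sumN-split k (n ∸ k) f ⟩
    sumN k f + sumN (n ∸ k) (λ i → f (k +ℕ i))       ≈⟨ +-congˡ (sumN-zero (n ∸ k) (λ i _ → late (k +ℕ i) (ℕ.m≤m+n k i))) ⟩
    sumN k f + 0#                                    ≈⟨ +-identityʳ _ ⟩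
    sumN k f                                         ∎

  sumN-single : ∀ n k (f : ℕ → Carrier) → k < n → (∀ j → j < n → j ≢ k → f j ≈ 0#) → sumN n f ≈ f k
  sumN-single (suc n) zero    f _   others =
    trans (+-congˡ (sumN-zero n (λ j j<n → others (suc j) (s≤s j<n) (λ ())))) (+-identityʳ _)
  sumN-single (suc n) (suc k) f k<n others =
    trans (+-cong (others 0 (s≤s z≤n) (λ ())) (sumN-single n k (λ j → f (suc j)) (ℕ.s≤s⁻¹ k<n)
            (λ j j<n j≢k → others (suc j) (s≤s j<n) (λ e → j≢k (ℕ.suc-injective e)))))
          (+-identityˡ _)

  sumN-reverse : ∀ n (f : ℕ → Carrier) → sumN n f ≈ sumN n (λ i → f (n ∸ suc i))
  sumN-reverse n f = begin
    sumN n f                                         ≡⟨ sumN≡sum n f ⟩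
    sum {n} (λ i → f (toℕ i))                        ≈⟨ ∑-permute {n} (λ i → f (toℕ i)) Permutation.reverse ⟩
    sum {n} (λ i → f (toℕ (opposite i)))             ≡⟨ sum-cong-≗ {n} (λ i → ≡.cong f (Fin.opposite-prop i)) ⟩
    sum {n} (λ i → f (n ∸ suc (toℕ i)))              ≡⟨ sumN≡sum n (λ i → f (n ∸ suc i)) ⟨
    sumN n (λ i → f (n ∸ suc i))                     ∎

  prodN-cong : ∀ n {f g : ℕ → Carrier} → (∀ k → k < n → f k ≈ g k) → prodN n f ≈ prodN n g
  prodN-cong zero    e = refl
  prodN-cong (suc n) e = *-cong (prodN-cong n (λ k k<n → e k (ℕ.m<n⇒m<1+n k<n))) (e n ℕ.≤-refl)

  prodN-head : ∀ n (f : ℕ → Carrier) → prodN (suc n) f ≈ f 0 * prodN n (λ k → f (suc k))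
  prodN-head zero    f = trans (*-identityˡ _) (sym (*-identityʳ _))
  prodN-head (suc n) f = trans (*-congʳ (prodN-head n f)) (*-assoc _ _ _)

  prodN-* : ∀ n (f g : ℕ → Carrier) → prodN n (λ k → f k * g k) ≈ prodN n f * prodN n g
  prodN-* zero    f g = sym (*-identityˡ _)
  prodN-* (suc n) f g = trans (*-congʳ (prodN-* n f g))
    (solve 4 (λ p p' x x' → (p :* p') :* (x :* x') := (p :* x) :* (p' :* x')) refl _ _ _ _)

  pow≡^ : ∀ x n → pow x n ≡ x ^ n
  pow≡^ x zero    = ≡.refl
  pow≡^ x (suc n) = ≡.cong (x *_) (pow≡^ x n)

  pow-+ : ∀ x m n → pow x (m +ℕ n) ≈ pow x m * pow x n
  pow-+ x m n rewrite pow≡^ x (m +ℕ n) | pow≡^ x m | pow≡^ x n = ^-homo-* x m n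

  pow-* : ∀ x y n → pow (x * y) n ≈ pow x n * pow y n
  pow-* x y n rewrite pow≡^ (x * y) n | pow≡^ x n | pow≡^ y n = ^-distrib-* x y n

  pow-cong : ∀ n {x y} → x ≈ y → pow x n ≈ pow y n
  pow-cong n {x} {y} x≈y rewrite pow≡^ x n | pow≡^ y n = ^-congˡ n x≈y

  prodN-pow-triangular : ∀ x n → prodN n (λ k → pow x (n ∸ k)) ≈ pow x (tri n)
  prodN-pow-triangular x zero    = refl
  prodN-pow-triangular x (suc n) = begin
    prodN (suc n) (λ k → pow x (suc n ∸ k))  ≈⟨ prodN-head n _ ⟩
    pow x (suc n) * prodN n (λ k → pow x (n ∸ k)) ≈⟨ *-congˡ (prodN-pow-triangular x n) ⟩
    pow x (suc n) * pow x (tri n)            ≈⟨ pow-+ x (suc n) (tri n) ⟨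
    pow x (suc n +ℕ tri n)                   ≡⟨ ≡.cong (pow x) (tri-suc n) ⟨
    pow x (tri (suc n))                      ∎

  -- Determinants

  Matrix : ℕ → Set c
  Matrix n = Fin n → Fin n → Carrier

  column : ∀ {n} → Matrix n → Fin n → Fin n → Carrier
  column M k i = M i k

  minor : ∀ {n} → Fin (suc n) → Matrix (suc n) → Matrix n
  minor j M i k = M (suc i) (punchIn j k)

  sign : ℕ → Carrier
  sign k = pow (- 1#) k

  laplaceTerm : ∀ {n} → Matrix (suc n) → Fin (suc n) → Carrier
  laplaceTerm {n} M j = sign (toℕ j) * M zero j * det n (minor j M)

  det-laplace : ∀ n (M : Matrix (suc n)) → det (suc n) M ≈ sum (laplaceTerm M)
  det-laplace n M = reflexive (sumF≡sum (suc n) (laplaceTerm M))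

  det-cong : ∀ n {M N : Matrix n} → (∀ i k → M i k ≈ N i k) → det n M ≈ det n N
  det-cong zero    e = refl
  det-cong (suc n) {M} {N} e = begin
    det (suc n) M        ≈⟨ det-laplace n M ⟩
    sum (laplaceTerm M)  ≈⟨ sum-cong-≋ {suc n} {laplaceTerm M} {laplaceTerm N}
                              (λ j → *-cong (*-congˡ (e zero j)) (det-cong n (λ i k → e (suc i) (punchIn j k)))) ⟩
    sum (laplaceTerm N)  ≈⟨ det-laplace n N ⟨
    det (suc n) N        ∎

  AgreeOutside : ∀ {n} → Fin n → Matrix n → Matrix n → Set ℓ
  AgreeOutside t X Y = ∀ i k → k ≢ t → X i k ≈ Y i k

  minor-agreeOutside : ∀ {n} {j t : Fin (suc n)} {X Y : Matrix (suc n)} (j≢t : j ≢ t) →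
                       AgreeOutside t X Y → AgreeOutside (punchOut j≢t) (minor j X) (minor j Y)
  minor-agreeOutside {j = j} j≢t XY i k k≢t′ =
    XY (suc i) (punchIn j k) (λ e → k≢t′ (Fin.punchIn-injective j k _ (≡.trans e (≡.sym (Fin.punchIn-punchOut j≢t)))))

  det-linear : ∀ n (t : Fin n) {X Y Z : Matrix n} a b → AgreeOutside t X Y → AgreeOutside t X Z →
               (∀ i → X i t ≈ a * Y i t + b * Z i t) → det n X ≈ a * det n Y + b * det n Z
  det-linear (suc n) t {X} {Y} {Z} a b XY XZ Xt = begin
    det (suc n) X                                                      ≈⟨ det-laplace n X ⟩
    sum (laplaceTerm X)                                                ≈⟨ sum-cong-≋ {suc n} {laplaceTerm X} term ⟩
    sum (λ j → a * laplaceTerm Y j + b * laplaceTerm Z j)              ≈⟨ ∑-distrib-+ (λ j → a * laplaceTerm Y j) (λ j → b * laplaceTerm Z j) ⟩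
    sum (λ j → a * laplaceTerm Y j) + sum (λ j → b * laplaceTerm Z j)  ≈⟨ +-cong (*-distribˡ-sum a (laplaceTerm Y)) (*-distribˡ-sum b (laplaceTerm Z)) ⟨
    a * sum (laplaceTerm Y) + b * sum (laplaceTerm Z)                  ≈⟨ +-cong (*-congˡ (det-laplace n Y)) (*-congˡ (det-laplace n Z)) ⟨
    a * det (suc n) Y + b * det (suc n) Z                              ∎
    where
    term : ∀ j → laplaceTerm X j ≈ a * laplaceTerm Y j + b * laplaceTerm Z j
    term j with j ≟ t
    ... | yes ≡.refl = begin
      sign (toℕ j) * X zero j * det n (minor j X)
        ≈⟨ *-congʳ (*-congˡ (Xt zero)) ⟩
      sign (toℕ j) * (a * Y zero j + b * Z zero j) * det n (minor j X)
        ≈⟨ solve 6 (λ s a b y z d → s :* (a :* y :+ b :* z) :* d := a :* (s :* y :* d) :+ b :* (s :* z :* d)) refl _ a b _ _ _ ⟩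
      a * (sign (toℕ j) * Y zero j * det n (minor j X)) + b * (sign (toℕ j) * Z zero j * det n (minor j X))
        ≈⟨ +-cong (*-congˡ (*-congˡ (det-cong n (λ i k → XY (suc i) (punchIn j k) (Fin.punchInᵢ≢i j k)))))
                  (*-congˡ (*-congˡ (det-cong n (λ i k → XZ (suc i) (punchIn j k) (Fin.punchInᵢ≢i j k))))) ⟩
      a * laplaceTerm Y j + b * laplaceTerm Z j ∎
    ... | no j≢t = begin
      sign (toℕ j) * X zero j * det n (minor j X)
        ≈⟨ *-congˡ (det-linear n (punchOut j≢t) a b (minor-agreeOutside j≢t XY) (minor-agreeOutside j≢t XZ) minorColumn) ⟩
      sign (toℕ j) * X zero j * (a * det n (minor j Y) + b * det n (minor j Z))
        ≈⟨ solve 6 (λ s a b x y z → s :* x :* (a :* y :+ b :* z) := a :* (s :* x :* y) :+ b :* (s :* x :* z)) refl _ a b _ _ _ ⟩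
      a * (sign (toℕ j) * X zero j * det n (minor j Y)) + b * (sign (toℕ j) * X zero j * det n (minor j Z))
        ≈⟨ +-cong (*-congˡ (*-congʳ (*-congˡ (XY zero j j≢t)))) (*-congˡ (*-congʳ (*-congˡ (XZ zero j j≢t)))) ⟩
      a * laplaceTerm Y j + b * laplaceTerm Z j ∎
      where
      minorColumn : ∀ i → minor j X i (punchOut j≢t) ≈ a * minor j Y i (punchOut j≢t) + b * minor j Z i (punchOut j≢t)
      minorColumn i rewrite Fin.punchIn-punchOut j≢t = Xt (suc i)

  det-additive : ∀ n (t : Fin n) {X Y Z : Matrix n} → AgreeOutside t X Y → AgreeOutside t X Z →
                 (∀ i → X i t ≈ Y i t + Z i t) → det n X ≈ det n Y + det n Z
  det-additive n t XY XZ Xt =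
    trans (det-linear n t 1# 1# XY XZ (λ i → trans (Xt i) (sym (+-cong (*-identityˡ _) (*-identityˡ _)))))
          (+-cong (*-identityˡ _) (*-identityˡ _))

  punchIn-adjacent : ∀ {n} (j : Fin (suc (suc n))) (c : Fin (suc n)) → j ≢ inject₁ c → j ≢ suc c →
                     Σ (Fin n) (λ c′ → punchIn j (inject₁ c′) ≡ inject₁ c × punchIn j (suc c′) ≡ suc c)
  punchIn-adjacent zero zero j≢c _ = ⊥-elim (j≢c ≡.refl)
  punchIn-adjacent zero (suc c) _ _ = c , ≡.refl , ≡.refl
  punchIn-adjacent {zero} (suc zero) zero _ j≢c+1 = ⊥-elim (j≢c+1 ≡.refl)
  punchIn-adjacent {suc n} (suc zero) zero _ j≢c+1 = ⊥-elim (j≢c+1 ≡.refl)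
  punchIn-adjacent {suc n} (suc (suc j)) zero _ _ = zero , ≡.refl , ≡.refl
  punchIn-adjacent {suc n} (suc j) (suc c) j≢c j≢c+1
    with punchIn-adjacent j c (λ e → j≢c (≡.cong suc e)) (λ e → j≢c+1 (≡.cong suc e))
  ... | c′ , e₁ , e₂ = suc c′ , ≡.cong suc e₁ , ≡.cong suc e₂

  punchIn-inject₁-suc : ∀ {n} (c k : Fin n) →
    punchIn (inject₁ c) k ≡ punchIn (suc c) k ⊎ (punchIn (inject₁ c) k ≡ suc c × punchIn (suc c) k ≡ inject₁ c)
  punchIn-inject₁-suc zero    zero    = inj₂ (≡.refl , ≡.refl)
  punchIn-inject₁-suc zero    (suc k) = inj₁ ≡.refl
  punchIn-inject₁-suc (suc c) zero    = inj₁ ≡.refl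
  punchIn-inject₁-suc (suc c) (suc k) with punchIn-inject₁-suc c k
  ... | inj₁ e          = inj₁ (≡.cong suc e)
  ... | inj₂ (e₁ , e₂) = inj₂ (≡.cong suc e₁ , ≡.cong suc e₂)

  sum-adjacent-pair : ∀ n (c : Fin (suc n)) (f : Fin (suc (suc n)) → Carrier) →
    (∀ j → j ≢ inject₁ c → j ≢ suc c → f j ≈ 0#) → f (inject₁ c) + f (suc c) ≈ 0# → sum f ≈ 0#
  sum-adjacent-pair n zero f outside pair =
    trans (sym (+-assoc _ _ _)) (trans (+-cong pair (sum-zero n (λ j → outside (suc (suc j)) (λ ()) (λ ())))) (+-identityʳ 0#))
  sum-adjacent-pair (suc n) (suc c) f outside pair =
    trans (+-cong (outside zero (λ ()) (λ ()))
                  (sum-adjacent-pair n c (λ j → f (suc j))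
                    (λ j j≢c j≢c+1 → outside (suc j) (λ e → j≢c (Fin.suc-injective e)) (λ e → j≢c+1 (Fin.suc-injective e))) pair))
          (+-identityˡ 0#)

  det-equal-adjacent-columns : ∀ n (M : Matrix (suc n)) (c : Fin n) →
                               (∀ i → M i (inject₁ c) ≈ M i (suc c)) → det (suc n) M ≈ 0#
  det-equal-adjacent-columns (suc n) M c Mc≈Mc+1 =
    trans (det-laplace (suc n) M) (sum-adjacent-pair n c (laplaceTerm M) outside pair)
    where
    outside : ∀ j → j ≢ inject₁ c → j ≢ suc c → laplaceTerm M j ≈ 0#
    outside j j≢c j≢c+1 with punchIn-adjacent j c j≢c j≢c+1
    ... | c′ , e₁ , e₂ = trans (*-congˡ (det-equal-adjacent-columns n (minor j M) c′ equal)) (zeroʳ _)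
      where
      equal : ∀ i → minor j M i (inject₁ c′) ≈ minor j M i (suc c′)
      equal i rewrite e₁ | e₂ = Mc≈Mc+1 (suc i)
    sameMinor : ∀ i k → minor (inject₁ c) M i k ≈ minor (suc c) M i k
    sameMinor i k with punchIn-inject₁-suc c k
    ... | inj₁ e          = reflexive (≡.cong (M (suc i)) e)
    ... | inj₂ (e₁ , e₂) rewrite e₁ | e₂ = sym (Mc≈Mc+1 (suc i))
    pair : laplaceTerm M (inject₁ c) + laplaceTerm M (suc c) ≈ 0#
    pair = begin
      laplaceTerm M (inject₁ c) + laplaceTerm M (suc c)
        ≈⟨ +-congʳ (*-cong (*-cong (reflexive (≡.cong sign (Fin.toℕ-inject₁ c))) (Mc≈Mc+1 zero)) (det-cong (suc n) sameMinor)) ⟩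
      t + (- 1# * sign (toℕ c)) * M zero (suc c) * det (suc n) (minor (suc c) M)
        ≈⟨ +-congˡ (trans (solve 4 (λ m s x d → m :* s :* x :* d := m :* (s :* x :* d)) refl _ _ _ _) (-1*x≈-x t)) ⟩
      t - t
        ≈⟨ -‿inverseʳ t ⟩
      0# ∎
      where
      t : Carrier
      t = sign (toℕ c) * M zero (suc c) * det (suc n) (minor (suc c) M)

  setColumn : ∀ {n} → Matrix n → Fin n → (Fin n → Carrier) → Matrix n
  setColumn M t u i k with k ≟ t
  ... | yes _ = u i
  ... | no  _ = M i k

  setColumn-at : ∀ {n} (M : Matrix n) t u i → setColumn M t u i t ≈ u i
  setColumn-at M t u i with t ≟ t
  ... | yes _   = refl
  ... | no t≢t = ⊥-elim (t≢t ≡.refl)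

  setColumn-outside : ∀ {n} (M : Matrix n) t u i k → k ≢ t → setColumn M t u i k ≈ M i k
  setColumn-outside M t u i k k≢t with k ≟ t
  ... | yes k≡t = ⊥-elim (k≢t k≡t)
  ... | no  _   = refl

  setColumn-column : ∀ {n} (M : Matrix n) t i k → setColumn M t (column M t) i k ≈ M i k
  setColumn-column M t i k with k ≟ t
  ... | yes ≡.refl = refl
  ... | no  _      = refl

  setColumn-agreeOutside : ∀ {n} (M : Matrix n) t u v → AgreeOutside t (setColumn M t u) (setColumn M t v)
  setColumn-agreeOutside M t u v i k k≢t = trans (setColumn-outside M t u i k k≢t) (sym (setColumn-outside M t v i k k≢t))

  setColumn-preserves-agreeOutside : ∀ {n} {X Y : Matrix n} {t} s v → AgreeOutside t X Y →
                                     AgreeOutside t (setColumn X s v) (setColumn Y s v)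
  setColumn-preserves-agreeOutside s v XY i k k≢t with k ≟ s
  ... | yes _ = refl
  ... | no  _ = XY i k k≢t

  swapAdjacent : ∀ {n} → Matrix (suc (suc n)) → Fin (suc n) → Matrix (suc (suc n))
  swapAdjacent M c = setColumn (setColumn M (inject₁ c) (column M (suc c))) (suc c) (column M (inject₁ c))

  suc≢inject₁ : ∀ {n} (c : Fin n) → suc c ≢ inject₁ c
  suc≢inject₁ c e = ℕ.1+n≢n (≡.trans (≡.cong toℕ e) (Fin.toℕ-inject₁ c))

  -- Expanding det W(u+v, u+v) = 0 by additivity in both columns leaves det W(u,v) + det W(v,u) = 0.
  det-swapAdjacent : ∀ n (M : Matrix (suc (suc n))) c → det (suc (suc n)) M ≈ - det (suc (suc n)) (swapAdjacent M c)
  det-swapAdjacent n M c = trans (det-cong N (λ i k → sym (W-uv i k))) (+-inverseˡ-unique _ _ (begin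
    Δ (W u v) + Δ (W v u)                                 ≈⟨ +-cong (+-identityˡ _) (+-identityʳ _) ⟨
    (0# + Δ (W u v)) + (Δ (W v u) + 0#)                   ≈⟨ +-cong (+-congʳ (vanish u)) (+-congˡ (vanish v)) ⟨
    (Δ (W u u) + Δ (W u v)) + (Δ (W v u) + Δ (W v v))     ≈⟨ +-cong (additive₂ u) (additive₂ v) ⟨
    Δ (W u (u ⊞ v)) + Δ (W v (u ⊞ v))                     ≈⟨ additive₁ (u ⊞ v) ⟨
    Δ (W (u ⊞ v) (u ⊞ v))                                 ≈⟨ vanish (u ⊞ v) ⟩
    0#                                                    ∎))
    where
    N : ℕ
    N = suc (suc n)
    Δ : Matrix N → Carrier
    Δ = det N
    p s : Fin N
    p = inject₁ c
    s = suc c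
    u v : Fin N → Carrier
    u = column M p
    v = column M s
    _⊞_ : (Fin N → Carrier) → (Fin N → Carrier) → Fin N → Carrier
    (x ⊞ y) i = x i + y i
    W : (Fin N → Carrier) → (Fin N → Carrier) → Matrix N
    W x y = setColumn (setColumn M p x) s y
    W-at-p : ∀ x y i → W x y i p ≈ x i
    W-at-p x y i = trans (setColumn-outside _ s y i p (λ e → suc≢inject₁ c (≡.sym e))) (setColumn-at M p x i)
    W-uv : ∀ i k → W u v i k ≈ M i k
    W-uv i k with k ≟ s
    ... | yes ≡.refl = refl
    ... | no _       = setColumn-column M p i k
    vanish : ∀ x → Δ (W x x) ≈ 0#
    vanish x = det-equal-adjacent-columns (suc n) (W x x) c (λ i → trans (W-at-p x x i) (sym (setColumn-at _ s x i)))
    additive₁ : ∀ y → Δ (W (u ⊞ v) y) ≈ Δ (W u y) + Δ (W v y)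
    additive₁ y = det-additive N p (setColumn-preserves-agreeOutside s y (setColumn-agreeOutside M p _ _))
                                   (setColumn-preserves-agreeOutside s y (setColumn-agreeOutside M p _ _))
                                   (λ i → trans (W-at-p _ y i) (sym (+-cong (W-at-p u y i) (W-at-p v y i))))
    additive₂ : ∀ x → Δ (W x (u ⊞ v)) ≈ Δ (W x u) + Δ (W x v)
    additive₂ x = det-additive N s (setColumn-agreeOutside _ s _ _) (setColumn-agreeOutside _ s _ _)
                                   (λ i → trans (setColumn-at _ s _ i) (sym (+-cong (setColumn-at _ s u i) (setColumn-at _ s v i))))

  -- Induction on d = toℕ k: swapping columns k − 1 and k moves the repeated column one step to the left.
  det-equal-columns : ∀ {n} d (M : Matrix n) {j k : Fin n} → toℕ k ≡ d → toℕ j < toℕ k →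
                      (∀ i → M i j ≈ M i k) → det n M ≈ 0#
  det-equal-columns d M {k = zero} _ () _
  det-equal-columns {suc zero} d M {k = suc ()} _ _ _
  det-equal-columns {suc (suc n)} zero M {k = suc c} () _ _
  det-equal-columns {suc (suc n)} (suc d) M {j} {suc c} k≡d j<k Mj≈Mk with j ≟ inject₁ c
  ... | yes ≡.refl = det-equal-adjacent-columns (suc n) M c Mj≈Mk
  ... | no j≢c = begin
    det (suc (suc n)) M                     ≈⟨ det-swapAdjacent n M c ⟩
    - det (suc (suc n)) (swapAdjacent M c)  ≈⟨ -‿cong (det-equal-columns d (swapAdjacent M c) c≡d j<c equal) ⟩
    - 0#                                    ≈⟨ -0#≈0# ⟩
    0#                                      ∎
    where
    c≡d : toℕ (inject₁ c) ≡ d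
    c≡d = ≡.trans (Fin.toℕ-inject₁ c) (ℕ.suc-injective k≡d)
    j<c : toℕ j < toℕ (inject₁ c)
    j<c = ≡.subst (toℕ j <_) (≡.sym (Fin.toℕ-inject₁ c))
            (ℕ.≤∧≢⇒< (ℕ.s≤s⁻¹ j<k) (λ e → j≢c (Fin.toℕ-injective (≡.trans e (≡.sym (Fin.toℕ-inject₁ c))))))
    equal : ∀ i → swapAdjacent M c i j ≈ swapAdjacent M c i (inject₁ c)
    equal i = begin
      swapAdjacent M c i j                    ≈⟨ setColumn-outside _ (suc c) _ i j (λ e → ℕ.<-irrefl (≡.cong toℕ e) j<k) ⟩
      setColumn M (inject₁ c) _ i j           ≈⟨ setColumn-outside M (inject₁ c) _ i j j≢c ⟩
      M i j                                   ≈⟨ Mj≈Mk i ⟩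
      M i (suc c)                             ≈⟨ setColumn-at M (inject₁ c) _ i ⟨
      setColumn M (inject₁ c) _ i (inject₁ c) ≈⟨ setColumn-outside _ (suc c) _ i (inject₁ c) (λ e → suc≢inject₁ c (≡.sym e)) ⟨
      swapAdjacent M c i (inject₁ c)          ∎

  det-linear-sum : ∀ m n (t : Fin n) {X Y : Matrix n} (w : Fin m → Carrier) (U : Fin m → Fin n → Carrier) →
    AgreeOutside t X Y → (∀ i → X i t ≈ Y i t + sum (λ l → w l * U l i)) →
    det n X ≈ det n Y + sum (λ l → w l * det n (setColumn Y t (U l)))
  det-linear-sum zero n t {X} {Y} w U XY Xt = trans (det-cong n XY′) (sym (+-identityʳ _))
    where
    XY′ : ∀ i k → X i k ≈ Y i k
    XY′ i k with k ≟ t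
    ... | yes ≡.refl = trans (Xt i) (+-identityʳ _)
    ... | no  k≢t    = XY i k k≢t
  det-linear-sum (suc m) n t {X} {Y} w U XY Xt = begin
    det n X                                                ≈⟨ det-linear n t 1# (w zero) XX′ XU₀ Xt′ ⟩
    1# * det n X′ + w zero * det n (setColumn Y t (U zero)) ≈⟨ +-congʳ (trans (*-identityˡ _)
                                                                (det-linear-sum m n t (λ l → w (suc l)) (λ l → U (suc l))
                                                                  (setColumn-outside Y t _) (setColumn-at Y t _))) ⟩
    (det n Y + rest) + w zero * det n (setColumn Y t (U zero)) ≈⟨ trans (+-assoc _ _ _) (+-congˡ (+-comm _ _)) ⟩
    det n Y + sum (λ l → w l * det n (setColumn Y t (U l))) ∎
    where
    rest : Carrier
    rest = sum (λ l → w (suc l) * det n (setColumn Y t (U (suc l))))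
    X′ : Matrix n
    X′ = setColumn Y t (λ i → Y i t + sum (λ l → w (suc l) * U (suc l) i))
    XX′ : AgreeOutside t X X′
    XX′ i k k≢t = trans (XY i k k≢t) (sym (setColumn-outside Y t _ i k k≢t))
    XU₀ : AgreeOutside t X (setColumn Y t (U zero))
    XU₀ i k k≢t = trans (XY i k k≢t) (sym (setColumn-outside Y t _ i k k≢t))
    Xt′ : ∀ i → X i t ≈ 1# * X′ i t + w zero * setColumn Y t (U zero) i t
    Xt′ i = trans (Xt i) (trans (solve 3 (λ y x r → y :+ (x :+ r) := con 1 :* (y :+ r) :+ x) refl _ _ _)
                                (+-cong (*-congˡ (sym (setColumn-at Y t _ i))) (*-congˡ (sym (setColumn-at Y t _ i)))))

  -- The matrices B t interpolate between N (t = 0) and A (t = n): their first t columns are those of A.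
  det-add-earlier-columns : ∀ n (A N : Matrix n) (w : Fin n → Fin n → Carrier) → (∀ l k → toℕ k ≤ toℕ l → w l k ≈ 0#) →
    (∀ i k → N i k ≈ A i k + sum (λ l → w l k * A i l)) → det n N ≈ det n A
  det-add-earlier-columns n A N w w-upper N≈A+wA =
    trans (det-cong n (λ i k → sym (B-late 0 i k λ ()))) (B-chain n 0 (ℕ.+-identityʳ n))
    where
    B : ℕ → Matrix n
    B t i k with toℕ k <? t
    ... | yes _ = A i k
    ... | no  _ = N i k
    B-early : ∀ t i k → toℕ k < t → B t i k ≈ A i k
    B-early t i k k<t with toℕ k <? t
    ... | yes _   = refl
    ... | no  k≮t = ⊥-elim (k≮t k<t)
    B-late : ∀ t i k → ¬ toℕ k < t → B t i k ≈ N i k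
    B-late t i k k≮t with toℕ k <? t
    ... | yes k<t = ⊥-elim (k≮t k<t)
    ... | no  _   = refl
    B-step : ∀ t → t < n → det n (B t) ≈ det n (B (suc t))
    B-step t t<n = begin
      det n (B t)
        ≈⟨ det-linear-sum n n kt (λ l → w l kt) (λ l i → A i l) agree column-kt ⟩
      det n (B (suc t)) + sum (λ l → w l kt * det n (setColumn (B (suc t)) kt (column A l)))
        ≈⟨ +-congˡ (sum-zero n vanishing) ⟩
      det n (B (suc t)) + 0#
        ≈⟨ +-identityʳ _ ⟩
      det n (B (suc t)) ∎
      where
      kt : Fin n
      kt = fromℕ< t<n
      kt≡t : toℕ kt ≡ t
      kt≡t = Fin.toℕ-fromℕ< t<n
      agree : AgreeOutside kt (B t) (B (suc t))
      agree i k k≢kt with toℕ k <? t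
      ... | yes k<t = sym (B-early (suc t) i k (ℕ.m<n⇒m<1+n k<t))
      ... | no  k≮t = sym (B-late (suc t) i k (λ k<1+t →
                        k≮t (ℕ.≤∧≢⇒< (ℕ.s≤s⁻¹ k<1+t) (λ e → k≢kt (Fin.toℕ-injective (≡.trans e (≡.sym kt≡t)))))))
      column-kt : ∀ i → B t i kt ≈ B (suc t) i kt + sum (λ l → w l kt * A i l)
      column-kt i = trans (B-late t i kt (λ kt<t → ℕ.<-irrefl kt≡t kt<t))
                          (trans (N≈A+wA i kt) (+-congʳ (sym (B-early (suc t) i kt (ℕ.≤-reflexive (≡.cong suc kt≡t))))))
      vanishing : ∀ l → w l kt * det n (setColumn (B (suc t)) kt (column A l)) ≈ 0#
      vanishing l with toℕ l <? t
      ... | no  l≮t = trans (*-congʳ (w-upper l kt (≡.subst (_≤ toℕ l) (≡.sym kt≡t) (ℕ.≮⇒≥ l≮t)))) (zeroˡ _)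
      ... | yes l<t = trans (*-congˡ (det-equal-columns _ S ≡.refl (≡.subst (toℕ l <_) (≡.sym kt≡t) l<t) equal)) (zeroʳ _)
        where
        S : Matrix n
        S = setColumn (B (suc t)) kt (column A l)
        equal : ∀ i → S i l ≈ S i kt
        equal i = begin
          S i l               ≈⟨ setColumn-outside (B (suc t)) kt _ i l (λ e → ℕ.<-irrefl (≡.trans (≡.cong toℕ e) kt≡t) l<t) ⟩
          B (suc t) i l       ≈⟨ B-early (suc t) i l (ℕ.m<n⇒m<1+n l<t) ⟩
          A i l               ≈⟨ setColumn-at (B (suc t)) kt _ i ⟨
          S i kt              ∎
    B-chain : ∀ s t → s +ℕ t ≡ n → det n (B t) ≈ det n A
    B-chain zero    t t≡n = det-cong n (λ i k → B-early t i k (≡.subst (toℕ k <_) (≡.sym t≡n) (Fin.toℕ<n k)))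
    B-chain (suc s) t s+t≡n =
      trans (B-step t (≡.subst (t <_) s+t≡n (ℕ.m<n+m t (s≤s z≤n)))) (B-chain s (suc t) (≡.trans (ℕ.+-suc s t) s+t≡n))

  -- Formal power series

  Series : Set c
  Series = ℕ → Carrier

  infix  4 _≋_
  infixl 6 _⊕_
  infixl 7 _⊛_

  _≋_ : Series → Series → Set ℓ
  A ≋ B = ∀ n → A n ≈ B n

  tail : Series → Series
  tail A n = A (suc n)

  _⊕_ : Series → Series → Series
  (A ⊕ B) n = A n + B n

  _⊛_ : Series → Series → Series
  (A ⊛ B) zero    = A 0 * B 0
  (A ⊛ B) (suc n) = A 0 * B (suc n) + (tail A ⊛ B) n

  𝟘 : Series
  𝟘 _ = 0#

  ι : Carrier → Series
  ι x zero    = x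
  ι x (suc _) = 0#

  z : Series
  z zero          = 0#
  z (suc zero)    = 1#
  z (suc (suc _)) = 0#

  σ : Carrier → Series → Series
  σ q A n = pow q n * A n

  ⊛-as-sum : ∀ n (A B : Series) → (A ⊛ B) n ≈ sumN (suc n) (λ r → A r * B (n ∸ r))
  ⊛-as-sum zero    A B = sym (+-identityʳ _)
  ⊛-as-sum (suc n) A B = +-congˡ (⊛-as-sum n (tail A) B)

  ⊛-cong : ∀ {A A′ B B′} → A ≋ A′ → B ≋ B′ → A ⊛ B ≋ A′ ⊛ B′
  ⊛-cong A≋A′ B≋B′ zero    = *-cong (A≋A′ 0) (B≋B′ 0)
  ⊛-cong A≋A′ B≋B′ (suc n) = +-cong (*-cong (A≋A′ 0) (B≋B′ (suc n))) (⊛-cong (λ m → A≋A′ (suc m)) B≋B′ n)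

  ⊛-zeroˡ : ∀ A → 𝟘 ⊛ A ≋ 𝟘
  ⊛-zeroˡ A zero    = zeroˡ _
  ⊛-zeroˡ A (suc n) = trans (+-cong (zeroˡ _) (⊛-zeroˡ A n)) (+-identityʳ 0#)

  ι-⊛ : ∀ x A n → (ι x ⊛ A) n ≈ x * A n
  ι-⊛ x A zero    = refl
  ι-⊛ x A (suc n) = trans (+-congˡ (⊛-zeroˡ A n)) (+-identityʳ _)

  ⊛-scaleˡ : ∀ x A B n → ((λ m → x * A m) ⊛ B) n ≈ x * (A ⊛ B) n
  ⊛-scaleˡ x A B zero    = *-assoc _ _ _
  ⊛-scaleˡ x A B (suc n) = trans (+-cong (*-assoc _ _ _) (⊛-scaleˡ x (tail A) B n)) (sym (distribˡ _ _ _))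

  ⊛-distribʳ : ∀ A B D → (A ⊕ B) ⊛ D ≋ A ⊛ D ⊕ B ⊛ D
  ⊛-distribʳ A B D zero    = distribʳ _ _ _
  ⊛-distribʳ A B D (suc n) = trans (+-cong (distribʳ _ _ _) (⊛-distribʳ (tail A) (tail B) D n))
                                   (solve 4 (λ a b c d → (a :+ b) :+ (c :+ d) := (a :+ c) :+ (b :+ d)) refl _ _ _ _)

  ⊛-comm : ∀ A B → A ⊛ B ≋ B ⊛ A
  ⊛-comm A B n = begin
    (A ⊛ B) n                                        ≈⟨ ⊛-as-sum n A B ⟩
    sumN (suc n) (λ r → A r * B (n ∸ r))             ≈⟨ sumN-reverse (suc n) (λ r → A r * B (n ∸ r)) ⟩
    sumN (suc n) (λ r → A (n ∸ r) * B (n ∸ (n ∸ r))) ≈⟨ sumN-cong (suc n) {λ r → A (n ∸ r) * B (n ∸ (n ∸ r))} (λ r r≤n →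
                                                          trans (*-comm _ _) (*-congʳ (reflexive (≡.cong B (ℕ.m∸[m∸n]≡n (ℕ.s≤s⁻¹ r≤n)))))) ⟩
    sumN (suc n) (λ r → B r * A (n ∸ r))             ≈⟨ ⊛-as-sum n B A ⟨
    (B ⊛ A) n                                        ∎

  ⊛-assoc : ∀ A B D → (A ⊛ B) ⊛ D ≋ A ⊛ (B ⊛ D)
  ⊛-assoc A B D zero    = *-assoc _ _ _
  ⊛-assoc A B D (suc n) = begin
    A 0 * B 0 * D (suc n) + (tail (A ⊛ B) ⊛ D) n
      ≈⟨ +-congˡ (⊛-distribʳ (λ m → A 0 * B (suc m)) (tail A ⊛ B) D n) ⟩
    A 0 * B 0 * D (suc n) + (((λ m → A 0 * B (suc m)) ⊛ D) n + ((tail A ⊛ B) ⊛ D) n)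
      ≈⟨ +-congˡ (+-cong (⊛-scaleˡ (A 0) (tail B) D n) (⊛-assoc (tail A) B D n)) ⟩
    A 0 * B 0 * D (suc n) + (A 0 * (tail B ⊛ D) n + (tail A ⊛ (B ⊛ D)) n)
      ≈⟨ solve 5 (λ a b c t u → a :* b :* c :+ (a :* t :+ u) := a :* (b :* c :+ t) :+ u) refl _ _ _ _ _ ⟩
    A 0 * (B ⊛ D) (suc n) + (tail A ⊛ (B ⊛ D)) n ∎

  Series-semiring : CommutativeSemiring c ℓ
  Series-semiring = record
    { Carrier = Series
    ; _≈_ = _≋_
    ; _+_ = _⊕_
    ; _*_ = _⊛_
    ; 0# = 𝟘
    ; 1# = ι 1#
    ; isCommutativeSemiring = record
      { isSemiring = record
        { isSemiringWithoutAnnihilatingZero = record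
          { +-isCommutativeMonoid = record
            { isMonoid = record
              { isSemigroup = record
                { isMagma = record
                  { isEquivalence = record
                    { refl = λ n → refl ; sym = λ e n → sym (e n) ; trans = λ e f n → trans (e n) (f n) }
                  ; ∙-cong = λ e f n → +-cong (e n) (f n) }
                ; assoc = λ A B D n → +-assoc _ _ _ }
              ; identity = (λ A n → +-identityˡ _) , (λ A n → +-identityʳ _) }
            ; comm = λ A B n → +-comm _ _ }
          ; *-cong = ⊛-cong
          ; *-assoc = ⊛-assoc
          ; *-identity = (λ A n → trans (ι-⊛ 1# A n) (*-identityˡ _))
                       , (λ A n → trans (⊛-comm A (ι 1#) n) (trans (ι-⊛ 1# A n) (*-identityˡ _)))
          ; distrib = (λ A B D n → trans (⊛-comm A (B ⊕ D) n)
                                     (trans (⊛-distribʳ B D A n) (+-cong (⊛-comm B A n) (⊛-comm D A n))))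
                    , (λ D A B → ⊛-distribʳ A B D) }
        ; zero = ⊛-zeroˡ , (λ A n → trans (⊛-comm A 𝟘 n) (⊛-zeroˡ A n)) }
      ; *-comm = ⊛-comm } }

  z-⊛-zero : ∀ A → (z ⊛ A) 0 ≈ 0#
  z-⊛-zero A = zeroˡ _

  z-⊛-suc : ∀ A n → (z ⊛ A) (suc n) ≈ A n
  z-⊛-suc A n = begin
    0# * A (suc n) + (tail z ⊛ A) n  ≈⟨ +-cong (zeroˡ _) (⊛-cong tail-z (λ _ → refl) n) ⟩
    0# + (ι 1# ⊛ A) n                ≈⟨ +-identityˡ _ ⟩
    (ι 1# ⊛ A) n                     ≈⟨ trans (ι-⊛ 1# A n) (*-identityˡ _) ⟩
    A n                              ∎
    where
    tail-z : tail z ≋ ι 1#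
    tail-z zero    = refl
    tail-z (suc _) = refl

  head-tail : ∀ A → A ≋ ι (A 0) ⊕ z ⊛ tail A
  head-tail A zero    = sym (trans (+-congˡ (z-⊛-zero (tail A))) (+-identityʳ _))
  head-tail A (suc n) = sym (trans (+-congˡ (z-⊛-suc (tail A) n)) (+-identityˡ _))

  equation-head : ∀ {X Y x} → X ≋ ι x ⊕ z ⊛ Y → X 0 ≈ x
  equation-head {Y = Y} X≋ = trans (X≋ 0) (trans (+-congˡ (z-⊛-zero Y)) (+-identityʳ _))

  equation-tail : ∀ {X Y x} → X ≋ ι x ⊕ z ⊛ Y → tail X ≋ Y
  equation-tail {Y = Y} X≋ m = trans (X≋ (suc m)) (trans (+-congˡ (z-⊛-suc Y m)) (+-identityˡ _))

  tail-affine : ∀ x y S m → tail (ι x ⊕ ι y ⊛ S) m ≈ y * tail S m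
  tail-affine x y S m = trans (+-identityˡ _) (ι-⊛ y S (suc m))

  ι-* : ∀ x y → ι (x * y) ≋ ι x ⊛ ι y
  ι-* x y n = sym (trans (ι-⊛ x (ι y) n) (lemma n))
    where
    lemma : ∀ n → x * ι y n ≈ ι (x * y) n
    lemma zero    = refl
    lemma (suc _) = zeroʳ x

  ι-+ : ∀ x y → ι (x + y) ≋ ι x ⊕ ι y
  ι-+ x y zero    = refl
  ι-+ x y (suc _) = sym (+-identityʳ 0#)

  σ-cong : ∀ q {A B} → A ≋ B → σ q A ≋ σ q B
  σ-cong q A≋B n = *-congˡ (A≋B n)

  σ-⊕ : ∀ q A B → σ q (A ⊕ B) ≋ σ q A ⊕ σ q B
  σ-⊕ q A B n = distribˡ _ _ _

  σ-ι : ∀ q x → σ q (ι x) ≋ ι x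
  σ-ι q x zero    = *-identityˡ x
  σ-ι q x (suc n) = zeroʳ _

  σ-⊛ : ∀ q A B → σ q (A ⊛ B) ≋ σ q A ⊛ σ q B
  σ-⊛ q A B zero    = trans (*-identityˡ _) (sym (*-cong (*-identityˡ _) (*-identityˡ _)))
  σ-⊛ q A B (suc n) = begin
    pow q (suc n) * (A 0 * B (suc n) + (tail A ⊛ B) n)
      ≈⟨ distribˡ _ _ _ ⟩
    pow q (suc n) * (A 0 * B (suc n)) + q * pow q n * (tail A ⊛ B) n
      ≈⟨ +-cong (solve 3 (λ p a b → p :* (a :* b) := con 1 :* a :* (p :* b)) refl _ _ _)
                (trans (*-assoc _ _ _) (*-congˡ (σ-⊛ q (tail A) B n))) ⟩
    1# * A 0 * (pow q (suc n) * B (suc n)) + q * (σ q (tail A) ⊛ σ q B) n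
      ≈⟨ +-congˡ (sym (trans (⊛-cong (λ m → *-assoc q (pow q m) (A (suc m))) (λ _ → refl) n)
                             (⊛-scaleˡ q (σ q (tail A)) (σ q B) n))) ⟩
    1# * A 0 * (pow q (suc n) * B (suc n)) + (tail (σ q A) ⊛ σ q B) n ∎

  σ-z : ∀ q → σ q z ≋ ι q ⊛ z
  σ-z q n = trans (lemma n) (sym (ι-⊛ q z n))
    where
    lemma : ∀ n → σ q z n ≈ q * z n
    lemma zero             = trans (zeroʳ _) (sym (zeroʳ _))
    lemma (suc zero)       = trans (*-identityʳ _) (trans (*-identityʳ _) (sym (*-identityʳ _)))
    lemma (suc (suc n))    = trans (zeroʳ _) (sym (zeroʳ _))

  ⊛-split : ∀ k j (h X : Series) →
    (h ⊛ X) (j +ℕ k) ≈ sumN (suc k) (λ l → h (k ∸ l) * X (j +ℕ l)) + sumN j (λ r → h (suc (r +ℕ k)) * X (j ∸ suc r))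
  ⊛-split zero j h X = begin
    (h ⊛ X) (j +ℕ 0)                                              ≡⟨ ≡.cong (h ⊛ X) (ℕ.+-identityʳ j) ⟩
    (h ⊛ X) j                                                     ≈⟨ ⊛-as-sum j h X ⟩
    h 0 * X j + sumN j (λ r → h (suc r) * X (j ∸ suc r))          ≈⟨ +-cong head rest ⟩
    (h 0 * X (j +ℕ 0) + 0#) + sumN j (λ r → h (suc (r +ℕ 0)) * X (j ∸ suc r)) ∎
    where
    head : h 0 * X j ≈ h 0 * X (j +ℕ 0) + 0#
    head = sym (trans (+-identityʳ _) (*-congˡ (reflexive (≡.cong X (ℕ.+-identityʳ j)))))
    rest : sumN j (λ r → h (suc r) * X (j ∸ suc r)) ≈ sumN j (λ r → h (suc (r +ℕ 0)) * X (j ∸ suc r))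
    rest = sumN-cong j (λ r _ → reflexive (≡.cong (λ u → h (suc u) * X (j ∸ suc r)) (≡.sym (ℕ.+-identityʳ r))))
  ⊛-split (suc k) j h X = begin
    (h ⊛ X) (j +ℕ suc k)                                  ≡⟨ ≡.cong (h ⊛ X) (ℕ.+-suc j k) ⟩
    h 0 * X (suc (j +ℕ k)) + (tail h ⊛ X) (j +ℕ k)        ≈⟨ +-congˡ (⊛-split k j (tail h) X) ⟩
    h 0 * X (suc (j +ℕ k)) + (S₁ + S₂)                    ≈⟨ solve 3 (λ x s t → x :+ (s :+ t) := (s :+ x) :+ t) refl _ _ _ ⟩
    (S₁ + h 0 * X (suc (j +ℕ k))) + S₂                    ≈⟨ +-cong first second ⟩
    sumN (suc (suc k)) (λ l → h (suc k ∸ l) * X (j +ℕ l)) + sumN j (λ r → h (suc (r +ℕ suc k)) * X (j ∸ suc r)) ∎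
    where
    S₁ S₂ : Carrier
    S₁ = sumN (suc k) (λ l → h (suc (k ∸ l)) * X (j +ℕ l))
    S₂ = sumN j (λ r → h (suc (suc (r +ℕ k))) * X (j ∸ suc r))
    first : S₁ + h 0 * X (suc (j +ℕ k)) ≈ sumN (suc (suc k)) (λ l → h (suc k ∸ l) * X (j +ℕ l))
    first = sym (trans (sumN-last (suc k) (λ l → h (suc k ∸ l) * X (j +ℕ l)))
      (+-cong (sumN-cong (suc k) (λ l l≤k → reflexive (≡.cong (λ u → h u * X (j +ℕ l)) (ℕ.+-∸-assoc 1 (ℕ.s≤s⁻¹ l≤k)))))
              (*-cong (reflexive (≡.cong h (ℕ.n∸n≡0 k))) (reflexive (≡.cong X (ℕ.+-suc j k))))))
    second : S₂ ≈ sumN j (λ r → h (suc (r +ℕ suc k)) * X (j ∸ suc r))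
    second = sumN-cong j (λ r _ → reflexive (≡.cong (λ u → h (suc u) * X (j ∸ suc r)) (≡.sym (ℕ.+-suc r k))))

  infix 4 _≈[_]_
  _≈[_]_ : Series → ℕ → Series → Set ℓ
  A ≈[ N ] B = ∀ m → m < N → A m ≈ B m

  Causal : (Series → Series) → Set (c ⊔ ℓ)
  Causal Φ = ∀ N {A B} → A ≈[ N ] B → Φ A ≈[ N ] Φ B

  ⊕-below : ∀ N {A A′ B B′} → A ≈[ N ] A′ → B ≈[ N ] B′ → A ⊕ B ≈[ N ] A′ ⊕ B′
  ⊕-below N A≈A′ B≈B′ m m<N = +-cong (A≈A′ m m<N) (B≈B′ m m<N)

  ⊛-below : ∀ N {A A′ B B′} → A ≈[ N ] A′ → B ≈[ N ] B′ → A ⊛ B ≈[ N ] A′ ⊛ B′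
  ⊛-below N {A} {A′} {B} {B′} A≈A′ B≈B′ m m<N = begin
    (A ⊛ B) m                                ≈⟨ ⊛-as-sum m A B ⟩
    sumN (suc m) (λ r → A r * B (m ∸ r))     ≈⟨ sumN-cong (suc m) {λ r → A r * B (m ∸ r)} (λ r r≤m →
                                                  *-cong (A≈A′ r (ℕ.≤-<-trans (ℕ.s≤s⁻¹ r≤m) m<N))
                                                         (B≈B′ (m ∸ r) (ℕ.≤-<-trans (ℕ.m∸n≤m m r) m<N))) ⟩
    sumN (suc m) (λ r → A′ r * B′ (m ∸ r))   ≈⟨ ⊛-as-sum m A′ B′ ⟨
    (A′ ⊛ B′) m                              ∎

  σ-below : ∀ q N {A B} → A ≈[ N ] B → σ q A ≈[ N ] σ q B
  σ-below q N A≈B m m<N = *-congˡ (A≈B m m<N)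

  z-⊛-below : ∀ N {A B} → A ≈[ N ] B → z ⊛ A ≈[ suc N ] z ⊛ B
  z-⊛-below N {A} {B} _   zero    _     = trans (z-⊛-zero A) (sym (z-⊛-zero B))
  z-⊛-below N {A} {B} A≈B (suc m) m<1+N = trans (z-⊛-suc A m) (trans (A≈B m (ℕ.s≤s⁻¹ m<1+N)) (sym (z-⊛-suc B m)))

  -- Coefficient m of z ⊛ Ψ X only depends on the coefficients of X below m.
  ≋-by-cancellation : ∀ {Ψ} → Causal Ψ → ∀ {X Y} → X ⊕ z ⊛ Ψ Y ≋ Y ⊕ z ⊛ Ψ X → X ≋ Y
  ≋-by-cancellation {Ψ} Ψ-causal {X} {Y} eq m = below (suc m) m ℕ.≤-refl
    where
    below : ∀ N → X ≈[ N ] Y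
    below (suc N) m m<1+N =
      +-cancelʳ _ (X m) (Y m) (trans (eq m) (+-congˡ (z-⊛-below N (Ψ-causal N (below N)) m m<1+N)))

  fixpoint-unique : ∀ {Φ} → Causal Φ → ∀ {A X Y} → X ≋ A ⊕ z ⊛ Φ X → Y ≋ A ⊕ z ⊛ Φ Y → X ≋ Y
  fixpoint-unique {Φ} Φ-causal {A} {X} {Y} X≋ Y≋ = ≋-by-cancellation Φ-causal (λ n → begin
    X n + (z ⊛ Φ Y) n                    ≈⟨ +-congʳ (X≋ n) ⟩
    A n + (z ⊛ Φ X) n + (z ⊛ Φ Y) n      ≈⟨ solve 3 (λ a x y → a :+ x :+ y := a :+ y :+ x) refl _ _ _ ⟩
    A n + (z ⊛ Φ Y) n + (z ⊛ Φ X) n      ≈⟨ +-congʳ (Y≋ n) ⟨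
    Y n + (z ⊛ Φ X) n                    ∎)

  -- Hankel determinants

  MatrixN : Set c
  MatrixN = ℕ → ℕ → Carrier

  detN : ℕ → MatrixN → Carrier
  detN n A = det n (λ i j → A (toℕ i) (toℕ j))

  infixl 7 _·[_]_
  _·[_]_ : MatrixN → ℕ → MatrixN → MatrixN
  (A ·[ n ] B) i k = sumN n (λ j → A i j * B j k)

  Lower : MatrixN → Set ℓ
  Lower A = ∀ i j → i < j → A i j ≈ 0#

  lowerRight : MatrixN → MatrixN
  lowerRight A i j = A (suc i) (suc j)

  diagProd : ℕ → MatrixN → Carrier
  diagProd zero    A = 1#
  diagProd (suc n) A = A 0 0 * diagProd n (lowerRight A)

  hankel : Series → MatrixN
  hankel X i j = X (i +ℕ j)

  toeplitz : Series → MatrixN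
  toeplitz X i       zero    = X i
  toeplitz X zero    (suc j) = 0#
  toeplitz X (suc i) (suc j) = toeplitz X i j

  extend : MatrixN → MatrixN
  extend A zero    zero    = 1#
  extend A zero    (suc k) = 0#
  extend A (suc i) zero    = 0#
  extend A (suc i) (suc k) = A i k

  identity : MatrixN
  identity zero    zero    = 1#
  identity zero    (suc _) = 0#
  identity (suc _) zero    = 0#
  identity (suc i) (suc j) = identity i j

  detN-cong : ∀ n {A B : MatrixN} → (∀ i j → i < n → j < n → A i j ≈ B i j) → detN n A ≈ detN n B
  detN-cong n A≈B = det-cong n (λ i j → A≈B (toℕ i) (toℕ j) (Fin.toℕ<n i) (Fin.toℕ<n j))

  detN-first-row : ∀ n (A : MatrixN) → (∀ j → j < n → A 0 (suc j) ≈ 0#) → detN (suc n) A ≈ A 0 0 * detN n (lowerRight A)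
  detN-first-row n A row0 = begin
    detN (suc n) A                                                           ≈⟨ det-laplace n A′ ⟩
    1# * A 0 0 * detN n (lowerRight A) + sum (λ j → laplaceTerm A′ (suc j))  ≈⟨ +-cong (*-congʳ (*-identityˡ _)) (sum-zero n vanishing) ⟩
    A 0 0 * detN n (lowerRight A) + 0#                                       ≈⟨ +-identityʳ _ ⟩
    A 0 0 * detN n (lowerRight A)                                            ∎
    where
    A′ : Matrix (suc n)
    A′ i j = A (toℕ i) (toℕ j)
    vanishing : ∀ j → laplaceTerm A′ (suc j) ≈ 0#
    vanishing j = trans (*-congʳ (trans (*-congˡ (row0 (toℕ j) (Fin.toℕ<n j))) (zeroʳ _))) (zeroˡ _)

  detN-add-earlier-columns : ∀ n (A N : MatrixN) (w : ℕ → ℕ → Carrier) →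
    (∀ i k → i < n → k < n → N i k ≈ A i k + sumN k (λ l → w l k * A i l)) → detN n N ≈ detN n A
  detN-add-earlier-columns n A N w N≈A+wA =
    det-add-earlier-columns n (λ i k → A (toℕ i) (toℕ k)) (λ i k → N (toℕ i) (toℕ k)) (λ l k → w′ (toℕ l) (toℕ k))
                            w′-upper N≈A+w′A
    where
    w′ : ℕ → ℕ → Carrier
    w′ l k with l <? k
    ... | yes _ = w l k
    ... | no  _ = 0#
    w′-upper : ∀ (l k : Fin n) → toℕ k ≤ toℕ l → w′ (toℕ l) (toℕ k) ≈ 0#
    w′-upper l k k≤l with toℕ l <? toℕ k
    ... | yes l<k = ⊥-elim (ℕ.<⇒≱ l<k k≤l)
    ... | no  _   = refl
    N≈A+w′A : ∀ (i k : Fin n) → N (toℕ i) (toℕ k) ≈ A (toℕ i) (toℕ k) + sum {n} (λ l → w′ (toℕ l) (toℕ k) * A (toℕ i) (toℕ l))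
    N≈A+w′A i k = trans (N≈A+wA _ _ (Fin.toℕ<n i) (Fin.toℕ<n k)) (+-congˡ (sym (begin
      sum {n} (λ l → w′ (toℕ l) (toℕ k) * A (toℕ i) (toℕ l)) ≡⟨ sumN≡sum n (λ l → w′ l (toℕ k) * A (toℕ i) l) ⟨
      sumN n (λ l → w′ l (toℕ k) * A (toℕ i) l)           ≈⟨ sumN-truncate _ (ℕ.<⇒≤ (Fin.toℕ<n k)) late ⟩
      sumN (toℕ k) (λ l → w′ l (toℕ k) * A (toℕ i) l)     ≈⟨ sumN-cong (toℕ k) early ⟩
      sumN (toℕ k) (λ l → w l (toℕ k) * A (toℕ i) l)      ∎)))
      where
      late : ∀ l → toℕ k ≤ l → w′ l (toℕ k) * A (toℕ i) l ≈ 0#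
      late l k≤l with l <? toℕ k
      ... | yes l<k = ⊥-elim (ℕ.<⇒≱ l<k k≤l)
      ... | no  _   = zeroˡ _
      early : ∀ l → l < toℕ k → w′ l (toℕ k) * A (toℕ i) l ≈ w l (toℕ k) * A (toℕ i) l
      early l l<k with l <? toℕ k
      ... | yes _   = refl
      ... | no  l≮k = ⊥-elim (l≮k l<k)

  ·-assoc : ∀ n (A B D : MatrixN) i k → (A ·[ n ] (B ·[ n ] D)) i k ≈ ((A ·[ n ] B) ·[ n ] D) i k
  ·-assoc n A B D i k = begin
    sumN n (λ j → A i j * sumN n (λ r → B j r * D r k))     ≈⟨ sumN-cong n (λ j _ → sym (sumN-*ˡ n (A i j) (λ r → B j r * D r k))) ⟩
    sumN n (λ j → sumN n (λ r → A i j * (B j r * D r k)))   ≈⟨ sumN-swap n n (λ j r → A i j * (B j r * D r k)) ⟩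
    sumN n (λ r → sumN n (λ j → A i j * (B j r * D r k)))   ≈⟨ sumN-cong n (λ r _ → trans (sumN-cong n (λ j _ → sym (*-assoc _ _ _)))
                                                                  (trans (sumN-cong n (λ j _ → *-comm _ _)) (trans (sumN-*ˡ n (D r k) _) (*-comm _ _)))) ⟩
    sumN n (λ r → sumN n (λ j → A i j * B j r) * D r k)     ∎

  ·-scale : ∀ n (L B B′ : MatrixN) x → (∀ j k → B j k ≈ x * B′ j k) → ∀ i k → (L ·[ n ] B) i k ≈ ((λ i j → L i j * x) ·[ n ] B′) i k
  ·-scale n L B B′ x B≈xB′ i k = sumN-cong n (λ j _ → trans (*-congˡ (B≈xB′ j k)) (sym (*-assoc _ _ _)))

  ·-Lower : ∀ n {A B} → Lower A → Lower B → Lower (A ·[ n ] B)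
  ·-Lower n {A} {B} A-lower B-lower i j i<j = sumN-zero n vanishing
    where
    vanishing : ∀ k → k < n → A i k * B k j ≈ 0#
    vanishing k _ with k ≤? i
    ... | yes k≤i = trans (*-congˡ (B-lower k j (ℕ.≤-<-trans k≤i i<j))) (zeroʳ _)
    ... | no  k≰i = trans (*-congʳ (A-lower i k (ℕ.≰⇒> k≰i))) (zeroˡ _)

  ·-diagonal : ∀ n {A B} → Lower A → Lower B → ∀ i → i < n → (A ·[ n ] B) i i ≈ A i i * B i i
  ·-diagonal n {A} {B} A-lower B-lower i i<n = sumN-single n i _ i<n vanishing
    where
    vanishing : ∀ k → k < n → k ≢ i → A i k * B k i ≈ 0#
    vanishing k _ k≢i with k <? i
    ... | yes k<i = trans (*-congˡ (B-lower k i k<i)) (zeroʳ _)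
    ... | no  k≮i = trans (*-congʳ (A-lower i k (ℕ.≤∧≢⇒< (ℕ.≮⇒≥ k≮i) (λ e → k≢i (≡.sym e))))) (zeroˡ _)

  lowerRight-Lower : ∀ {A} → Lower A → Lower (lowerRight A)
  lowerRight-Lower A-lower i j i<j = A-lower (suc i) (suc j) (s≤s i<j)

  scaled-Lower : ∀ {A} x → Lower A → Lower (λ i j → A i j * x)
  scaled-Lower x A-lower i j i<j = trans (*-congʳ (A-lower i j i<j)) (zeroˡ x)

  diagProd-scaled : ∀ n (A A′ : MatrixN) x → (∀ i → i < n → A′ i i ≈ A i i * x) → diagProd n A′ ≈ diagProd n A * pow x n
  diagProd-scaled zero    A A′ x _    = sym (*-identityʳ 1#)
  diagProd-scaled (suc n) A A′ x A′≈Ax = begin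
    A′ 0 0 * diagProd n (lowerRight A′)                       ≈⟨ *-cong (A′≈Ax 0 (s≤s z≤n))
                                                                    (diagProd-scaled n _ _ x (λ i i<n → A′≈Ax (suc i) (s≤s i<n))) ⟩
    A 0 0 * x * (diagProd n (lowerRight A) * pow x n)         ≈⟨ solve 4 (λ a x d p → a :* x :* (d :* p) := a :* d :* (x :* p)) refl _ _ _ _ ⟩
    A 0 0 * diagProd n (lowerRight A) * (x * pow x n)         ∎

  toeplitz-Lower : ∀ X → Lower (toeplitz X)
  toeplitz-Lower X zero    (suc j) _   = refl
  toeplitz-Lower X (suc i) (suc j) i<j = toeplitz-Lower X i j (ℕ.s≤s⁻¹ i<j)

  toeplitz-entry : ∀ X i j → j ≤ i → toeplitz X i j ≡ X (i ∸ j)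
  toeplitz-entry X i       zero    _   = ≡.refl
  toeplitz-entry X (suc i) (suc j) j≤i = toeplitz-entry X i j (ℕ.s≤s⁻¹ j≤i)

  toeplitz-diagonal : ∀ X i → toeplitz X i i ≡ X 0
  toeplitz-diagonal X i = ≡.trans (toeplitz-entry X i i ℕ.≤-refl) (≡.cong X (ℕ.n∸n≡0 i))

  detN-·-extend : ∀ n (B A : MatrixN) → Lower B → detN (suc n) (B ·[ suc n ] extend A) ≈ B 0 0 * detN n (lowerRight B ·[ n ] A)
  detN-·-extend n B A B-lower = begin
    detN (suc n) (B ·[ suc n ] extend A)                                 ≈⟨ detN-first-row n (B ·[ suc n ] extend A) first-row ⟩
    (B ·[ suc n ] extend A) 0 0 * detN n (lowerRight (B ·[ suc n ] extend A)) ≈⟨ *-cong corner (detN-cong n (λ i k _ _ → block i k)) ⟩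
    B 0 0 * detN n (lowerRight B ·[ n ] A)                               ∎
    where
    first-row : ∀ k → k < n → (B ·[ suc n ] extend A) 0 (suc k) ≈ 0#
    first-row k _ = trans (+-cong (zeroʳ _) (sumN-zero n (λ r _ → trans (*-congʳ (B-lower 0 (suc r) (s≤s z≤n))) (zeroˡ _))))
                          (+-identityʳ 0#)
    corner : (B ·[ suc n ] extend A) 0 0 ≈ B 0 0
    corner = trans (+-cong (*-identityʳ _) (sumN-zero n (λ r _ → zeroʳ _))) (+-identityʳ _)
    block : ∀ i k → lowerRight (B ·[ suc n ] extend A) i k ≈ (lowerRight B ·[ n ] A) i k
    block i k = trans (+-congʳ (zeroʳ _)) (+-identityˡ _)

  ·-column-combination : ∀ n (L A B : MatrixN) (w : ℕ → ℕ → Carrier) i k →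
    (∀ j → j < n → B j k ≈ A j k + sumN k (λ l → w l k * A j l)) →
    (L ·[ n ] B) i k ≈ (L ·[ n ] A) i k + sumN k (λ l → w l k * (L ·[ n ] A) i l)
  ·-column-combination n L A B w i k B≈A+wA = begin
    sumN n (λ j → L i j * B j k)
      ≈⟨ sumN-cong n (λ j j<n → trans (*-congˡ (B≈A+wA j j<n)) (distribˡ _ _ _)) ⟩
    sumN n (λ j → L i j * A j k + L i j * sumN k (λ l → w l k * A j l))
      ≈⟨ sumN-+ n _ _ ⟩
    (L ·[ n ] A) i k + sumN n (λ j → L i j * sumN k (λ l → w l k * A j l))
      ≈⟨ +-congˡ (sumN-cong n (λ j _ → trans (sym (sumN-*ˡ k (L i j) _))
                    (sumN-cong k (λ l _ → solve 3 (λ x y u → x :* (y :* u) := y :* (x :* u)) refl _ _ _)))) ⟩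
    (L ·[ n ] A) i k + sumN n (λ j → sumN k (λ l → w l k * (L i j * A j l)))
      ≈⟨ +-congˡ (sumN-swap n k (λ j l → w l k * (L i j * A j l))) ⟩
    (L ·[ n ] A) i k + sumN k (λ l → sumN n (λ j → w l k * (L i j * A j l)))
      ≈⟨ +-congˡ (sumN-cong k (λ l _ → sumN-*ˡ n (w l k) (λ j → L i j * A j l))) ⟩
    (L ·[ n ] A) i k + sumN k (λ l → w l k * (L ·[ n ] A) i l) ∎

  toeplitz-·-extend : ∀ n (X h : Series) → tail X ≋ h ⊛ X → ∀ j k → j < suc n →
    (toeplitz X ·[ suc n ] extend (hankel (tail h))) j k ≈ hankel X j k + sumN k (λ l → - h (k ∸ suc l) * hankel X j l)
  toeplitz-·-extend n X h X-rec j zero j≤n = begin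
    X j * 1# + sumN n (λ r → toeplitz X j (suc r) * 0#)  ≈⟨ +-cong (*-identityʳ _) (sumN-zero n (λ r _ → zeroʳ _)) ⟩
    X j + 0#                                              ≡⟨ ≡.cong (λ m → X m + 0#) (ℕ.+-identityʳ j) ⟨
    X (j +ℕ 0) + 0#                                       ∎
  toeplitz-·-extend n X h X-rec j (suc k) j≤n = begin
    X j * 0# + sumN n (λ r → toeplitz X j (suc r) * h (suc (r +ℕ k)))
      ≈⟨ trans (+-congʳ (zeroʳ _)) (+-identityˡ _) ⟩
    sumN n (λ r → toeplitz X j (suc r) * h (suc (r +ℕ k)))
      ≈⟨ sumN-truncate _ (ℕ.s≤s⁻¹ j≤n) (λ r j≤r → trans (*-congʳ (toeplitz-Lower X j (suc r) (s≤s j≤r))) (zeroˡ _)) ⟩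
    sumN j (λ r → toeplitz X j (suc r) * h (suc (r +ℕ k)))
      ≈⟨ sumN-cong j (λ r r<j → trans (*-congʳ (reflexive (toeplitz-entry X j (suc r) r<j))) (*-comm _ _)) ⟩
    S₂
      ≈⟨ +-identityˡ S₂ ⟨
    0# + S₂
      ≈⟨ +-congʳ cancel ⟨
    (S₁ + S₁′) + S₂
      ≈⟨ solve 3 (λ s s′ t → (s :+ s′) :+ t := (s :+ t) :+ s′) refl _ _ _ ⟩
    (S₁ + S₂) + S₁′
      ≈⟨ +-congʳ (sym (trans (reflexive (≡.cong X (ℕ.+-suc j k))) (trans (X-rec (j +ℕ k)) (⊛-split k j h X)))) ⟩
    X (j +ℕ suc k) + S₁′ ∎
    where
    S₁ S₁′ S₂ : Carrier
    S₁  = sumN (suc k) (λ l → h (k ∸ l) * X (j +ℕ l))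
    S₁′ = sumN (suc k) (λ l → - h (k ∸ l) * X (j +ℕ l))
    S₂  = sumN j (λ r → h (suc (r +ℕ k)) * X (j ∸ suc r))
    cancel : S₁ + S₁′ ≈ 0#
    cancel = trans (sym (sumN-+ (suc k) (λ l → h (k ∸ l) * X (j +ℕ l)) (λ l → - h (k ∸ l) * X (j +ℕ l))))
                   (sumN-zero (suc k) (λ l _ →
               trans (sym (distribʳ (X (j +ℕ l)) _ _)) (trans (*-congʳ (-‿inverseʳ (h (k ∸ l)))) (zeroˡ _))))

  -- Adding multiples of earlier columns turns L·hankel X into L·(toeplitz X)·(1 ⊕ hankel (tail h)),
  -- whose first row is (L 0 0 * X 0, 0, 0, …).
  hankel-step : ∀ n (X h : Series) (L : MatrixN) → Lower L → tail X ≋ h ⊛ X →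
    detN (suc n) (L ·[ suc n ] hankel X) ≈ L 0 0 * X 0 * detN n (lowerRight (L ·[ suc n ] toeplitz X) ·[ n ] hankel (tail h))
  hankel-step n X h L L-lower X-rec = begin
    detN (suc n) (L ·[ suc n ] hankel X)
      ≈⟨ detN-add-earlier-columns (suc n) (L ·[ suc n ] hankel X) (L ·[ suc n ] (T ·[ suc n ] E)) (λ l k → - h (k ∸ suc l))
           (λ i k _ _ → ·-column-combination (suc n) L (hankel X) (T ·[ suc n ] E) (λ l k → - h (k ∸ suc l)) i k
                          (λ j j≤n → toeplitz-·-extend n X h X-rec j k j≤n)) ⟨
    detN (suc n) (L ·[ suc n ] (T ·[ suc n ] E))
      ≈⟨ detN-cong (suc n) (λ i k _ _ → ·-assoc (suc n) L T E i k) ⟩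
    detN (suc n) ((L ·[ suc n ] T) ·[ suc n ] E)
      ≈⟨ detN-·-extend n (L ·[ suc n ] T) (hankel (tail h)) (·-Lower (suc n) L-lower (toeplitz-Lower X)) ⟩
    (L ·[ suc n ] T) 0 0 * detN n (lowerRight (L ·[ suc n ] T) ·[ n ] hankel (tail h))
      ≈⟨ *-congʳ (·-diagonal (suc n) L-lower (toeplitz-Lower X) 0 (s≤s z≤n)) ⟩
    L 0 0 * X 0 * detN n (lowerRight (L ·[ suc n ] T) ·[ n ] hankel (tail h)) ∎
    where
    T E : MatrixN
    T = toeplitz X
    E = extend (hankel (tail h))

  -- The hypotheses say X = x₀ / (1 − z h) and h − h 0 = c (Y − Y 0).
  hankel-reduction : ∀ n (X h Y : Series) {x₀ c D : Carrier} (L : MatrixN) → Lower L →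
    tail X ≋ h ⊛ X → X 0 ≈ x₀ → (∀ m → tail h m ≈ c * tail Y m) →
    (∀ L′ → Lower L′ → detN n (L′ ·[ n ] hankel (tail Y)) ≈ diagProd n L′ * D) →
    detN (suc n) (L ·[ suc n ] hankel X) ≈ diagProd (suc n) L * (x₀ * pow (x₀ * c) n * D)
  hankel-reduction n X h Y {x₀} {c} {D} L L-lower X-rec X₀≈x₀ h≈cY reduced = begin
    detN (suc n) (L ·[ suc n ] hankel X)
      ≈⟨ hankel-step n X h L L-lower X-rec ⟩
    L 0 0 * X 0 * detN n (L′ ·[ n ] hankel (tail h))
      ≈⟨ *-cong (*-congˡ X₀≈x₀) (detN-cong n (λ i k _ _ → ·-scale n L′ _ _ c (λ j k → h≈cY (j +ℕ k)) i k)) ⟩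
    L 0 0 * x₀ * detN n (L′c ·[ n ] hankel (tail Y))
      ≈⟨ *-congˡ (reduced L′c (scaled-Lower c (lowerRight-Lower (·-Lower (suc n) L-lower (toeplitz-Lower X))))) ⟩
    L 0 0 * x₀ * (diagProd n L′c * D)
      ≈⟨ *-congˡ (*-congʳ (diagProd-scaled n (lowerRight L) L′c (x₀ * c) L′c-diagonal)) ⟩
    L 0 0 * x₀ * (diagProd n (lowerRight L) * pow (x₀ * c) n * D)
      ≈⟨ solve 5 (λ l x d p e → l :* x :* (d :* p :* e) := l :* d :* (x :* p :* e)) refl _ _ _ _ _ ⟩
    diagProd (suc n) L * (x₀ * pow (x₀ * c) n * D) ∎
    where
    L′ L′c : MatrixN
    L′ = lowerRight (L ·[ suc n ] toeplitz X)
    L′c i j = L′ i j * c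
    L′c-diagonal : ∀ i → i < n → L′c i i ≈ lowerRight L i i * (x₀ * c)
    L′c-diagonal i i<n = begin
      L′ i i * c                                      ≈⟨ *-congʳ (·-diagonal (suc n) L-lower (toeplitz-Lower X) (suc i) (s≤s i<n)) ⟩
      L (suc i) (suc i) * toeplitz X (suc i) (suc i) * c ≈⟨ *-congʳ (*-congˡ (trans (reflexive (toeplitz-diagonal X (suc i))) X₀≈x₀)) ⟩
      L (suc i) (suc i) * x₀ * c                      ≈⟨ *-assoc _ _ _ ⟩
      lowerRight L i i * (x₀ * c)                     ∎

  identity-Lower : Lower identity
  identity-Lower zero    (suc j) _   = refl
  identity-Lower (suc i) (suc j) i<j = identity-Lower i j (ℕ.s≤s⁻¹ i<j)

  identity-· : ∀ n (A : MatrixN) i k → i < n → (identity ·[ n ] A) i k ≈ A i k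
  identity-· n A i k i<n = trans (sumN-single n i _ i<n off-diagonal) (trans (*-congʳ (diagonal i)) (*-identityˡ _))
    where
    diagonal : ∀ i → identity i i ≈ 1#
    diagonal zero    = refl
    diagonal (suc i) = diagonal i
    off : ∀ i j → j ≢ i → identity i j ≈ 0#
    off zero    zero    j≢i = ⊥-elim (j≢i ≡.refl)
    off zero    (suc j) _   = refl
    off (suc i) zero    _   = refl
    off (suc i) (suc j) j≢i = off i j (λ e → j≢i (≡.cong suc e))
    off-diagonal : ∀ j → j < n → j ≢ i → identity i j * A j k ≈ 0#
    off-diagonal j _ j≢i = trans (*-congʳ (off i j j≢i)) (zeroˡ _)

  diagProd-identity : ∀ n → diagProd n identity ≈ 1#
  diagProd-identity zero    = refl
  diagProd-identity (suc n) = trans (*-identityˡ _) (diagProd-identity n)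

  detN-via-identity : ∀ n (A : MatrixN) D → (∀ L → Lower L → detN n (L ·[ n ] A) ≈ diagProd n L * D) → detN n A ≈ D
  detN-via-identity n A D lower-multiple = begin
    detN n A                           ≈⟨ detN-cong n (λ i k i<n _ → identity-· n A i k i<n) ⟨
    detN n (identity ·[ n ] A)         ≈⟨ lower-multiple identity identity-Lower ⟩
    diagProd n identity * D            ≈⟨ trans (*-congʳ (diagProd-identity n)) (*-identityˡ D) ⟩
    D                                  ∎

  -- The q-Narayana series

  open CommutativeSemiring Series-semiring using ()
    renaming (refl to ≋-refl; sym to ≋-sym; trans to ≋-trans; +-cong to ⊕-cong)

  snoc-last : ∀ n (t : Fin (suc n) → Carrier) x → snoc n t x (fromℕ (suc n)) ≡ x
  snoc-last zero    t x = ≡.refl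
  snoc-last (suc n) t x = snoc-last n (λ j → t (suc j)) x

  snoc-inject₁ : ∀ n (t : Fin (suc n) → Carrier) x (i : Fin (suc n)) → snoc n t x (inject₁ i) ≡ t i
  snoc-inject₁ zero    t x zero    = ≡.refl
  snoc-inject₁ (suc n) t x zero    = ≡.refl
  snoc-inject₁ (suc n) t x (suc i) = snoc-inject₁ n (λ j → t (suc j)) x i

  fromℕ-or-inject₁ : ∀ {n} (i : Fin (suc n)) → i ≡ fromℕ n ⊎ Σ (Fin n) (λ j → i ≡ inject₁ j)
  fromℕ-or-inject₁ {zero}  zero    = inj₁ ≡.refl
  fromℕ-or-inject₁ {suc n} zero    = inj₂ (zero , ≡.refl)
  fromℕ-or-inject₁ {suc n} (suc i) with fromℕ-or-inject₁ i
  ... | inj₁ e       = inj₁ (≡.cong suc e)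
  ... | inj₂ (j , e) = inj₂ (suc j , ≡.cong suc e)

  table-entry : ∀ a b q m (i : Fin (suc m)) → table a b q m i ≡ Cₙ a b q (toℕ i)
  table-entry a b q zero    zero = ≡.refl
  table-entry a b q (suc m) i with fromℕ-or-inject₁ i
  ... | inj₁ ≡.refl       = ≡.cong (Cₙ a b q) (≡.sym (Fin.toℕ-fromℕ (suc m)))
  ... | inj₂ (j , ≡.refl) = ≡.trans (snoc-inject₁ m (table a b q m) _ j)
                              (≡.trans (table-entry a b q m j) (≡.cong (Cₙ a b q) (≡.sym (Fin.toℕ-inject₁ j))))

  σ-affine : ∀ q a b X Y → σ q ((ι a ⊕ ι b ⊛ Y) ⊛ X) ≋ (ι a ⊕ ι b ⊛ σ q Y) ⊛ σ q X
  σ-affine q a b X Y = ≋-trans (σ-⊛ q _ X) (⊛-cong (≋-trans (σ-⊕ q _ _)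
                         (⊕-cong (σ-ι q a) (≋-trans (σ-⊛ q (ι b) Y) (⊛-cong (σ-ι q b) ≋-refl)))) ≋-refl)

  affine-causal : ∀ q A B → Causal (λ X → (A ⊕ B ⊛ σ q X) ⊛ X)
  affine-causal q A B N X≈Y = ⊛-below N (⊕-below N (λ _ _ → refl) (⊛-below N (λ _ _ → refl) (σ-below q N X≈Y))) X≈Y

  module _ (q : Carrier) where

    F : Carrier → Carrier → Series
    F a b n = Cₙ a b q n

    F-tail : ∀ a b → tail (F a b) ≋ (ι a ⊕ ι b ⊛ σ q (F a b)) ⊛ F a b
    F-tail a b m = begin
      table a b q (suc m) (fromℕ (suc m))
        ≡⟨ snoc-last m t _ ⟩
      a * t (fromℕ m) + b * sumF (suc m) (λ k → pow q (toℕ k) * t k * t (opposite k))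
        ≈⟨ +-cong (*-congˡ (reflexive (≡.trans (table-entry a b q m _) (≡.cong (F a b) (Fin.toℕ-fromℕ m)))))
                  (*-congˡ (trans (reflexive (sumF≡sum (suc m) terms)) (sum-cong-≋ {suc m} {terms} entries))) ⟩
      a * F a b m + b * sum {suc m} (λ k → σ q (F a b) (toℕ k) * F a b (m ∸ toℕ k))
        ≡⟨ ≡.cong (λ s → a * F a b m + b * s) (sumN≡sum (suc m) (λ k → σ q (F a b) k * F a b (m ∸ k))) ⟨
      a * F a b m + b * sumN (suc m) (λ k → σ q (F a b) k * F a b (m ∸ k))
        ≈⟨ +-congˡ (*-congˡ (⊛-as-sum m (σ q (F a b)) (F a b))) ⟨
      a * F a b m + b * (σ q (F a b) ⊛ F a b) m
        ≈⟨ +-cong (ι-⊛ a (F a b) m) (trans (⊛-assoc (ι b) (σ q (F a b)) (F a b) m) (ι-⊛ b _ m)) ⟨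
      (ι a ⊛ F a b) m + (ι b ⊛ σ q (F a b) ⊛ F a b) m
        ≈⟨ ⊛-distribʳ (ι a) (ι b ⊛ σ q (F a b)) (F a b) m ⟨
      ((ι a ⊕ ι b ⊛ σ q (F a b)) ⊛ F a b) m ∎
      where
      t : Fin (suc m) → Carrier
      t = table a b q m
      terms : Fin (suc m) → Carrier
      terms k = pow q (toℕ k) * t k * t (opposite k)
      entries : ∀ k → terms k ≈ σ q (F a b) (toℕ k) * F a b (m ∸ toℕ k)
      entries k = *-cong (*-congˡ (reflexive (table-entry a b q m k)))
                         (reflexive (≡.trans (table-entry a b q m (opposite k)) (≡.cong (F a b) (Fin.opposite-prop k))))

    F-equation : ∀ a b → F a b ≋ ι 1# ⊕ z ⊛ ((ι a ⊕ ι b ⊛ σ q (F a b)) ⊛ F a b)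
    F-equation a b = ≋-trans (head-tail (F a b)) (⊕-cong ≋-refl (⊛-cong ≋-refl (F-tail a b)))

    σ-F-equation : ∀ a b → σ q (F a b) ≋ ι 1# ⊕ ι q ⊛ z ⊛ ((ι a ⊕ ι b ⊛ σ q (σ q (F a b))) ⊛ σ q (F a b))
    σ-F-equation a b = ≋-trans (σ-cong q (F-equation a b)) (≋-trans (σ-⊕ q _ _)
      (⊕-cong (σ-ι q 1#) (≋-trans (σ-⊛ q z _) (⊛-cong (σ-z q) (σ-affine q a b (F a b) (σ q (F a b)))))))

    σ-F : ∀ a b → σ q (F a b) ≋ F (q * a) (q * b)
    σ-F a b = fixpoint-unique (affine-causal q (ι (q * a)) (ι (q * b))) σF-equation (F-equation (q * a) (q * b))
      where
      open Solver Series-semiring using () renaming (solve to solveₛ; _:+_ to _:⊕_; _:*_ to _:⊛_; _:=_ to _:≋_)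
      G = σ q (F a b)
      σF-equation : G ≋ ι 1# ⊕ z ⊛ ((ι (q * a) ⊕ ι (q * b) ⊛ σ q G) ⊛ G)
      σF-equation = ≋-trans (σ-F-equation a b) (⊕-cong ≋-refl (≋-trans
        (solveₛ 6 (λ q z a b G₂ G → q :⊛ z :⊛ ((a :⊕ b :⊛ G₂) :⊛ G) :≋ z :⊛ ((q :⊛ a :⊕ q :⊛ b :⊛ G₂) :⊛ G)) ≋-refl
                (ι q) z (ι a) (ι b) (σ q G) G)
        (⊛-cong ≋-refl (⊛-cong (⊕-cong (≋-sym (ι-* q a)) (⊛-cong (≋-sym (ι-* q b)) ≋-refl)) ≋-refl))))

    F-equation-qb : ∀ a b → F a (q * b) ≋ ι 1# ⊕ z ⊛ ((ι a ⊕ ι q ⊛ ι b ⊛ σ q (F a (q * b))) ⊛ F a (q * b))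
    F-equation-qb a b = ≋-trans (F-equation a (q * b))
      (⊕-cong ≋-refl (⊛-cong ≋-refl (⊛-cong (⊕-cong ≋-refl (⊛-cong (ι-* q b) ≋-refl)) ≋-refl)))

    -- Writing E = F a (q b): (Lh − Rh) = a (F − E) + b F (σ F − E), and the functional equations of
    -- F, σ F and E turn this into z ⊛ (Ψ Lh − Ψ Rh); `cross` is that computation with Kt added to both
    -- sides, so that no subtraction occurs.
    F-factorisation : ∀ a b → (ι a ⊕ ι b ⊛ σ q (F a b)) ⊛ F a b ≋ (ι a ⊕ ι b ⊛ F a b) ⊛ F a (q * b)
    F-factorisation a b = ≋-by-cancellation Ψ-causal cross
      where
      open Solver Series-semiring using () renaming (solve to solveₛ; _:+_ to _:⊕_; _:*_ to _:⊛_; _:=_ to _:≋_)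
      Fₐ G G₂ E E₁ Lh Rh c₁ c₂ Kt : Series
      Fₐ = F a b
      G  = σ q Fₐ
      G₂ = σ q G
      E  = F a (q * b)
      E₁ = σ q E
      Lh = (ι a ⊕ ι b ⊛ G) ⊛ Fₐ
      Rh = (ι a ⊕ ι b ⊛ Fₐ) ⊛ E
      c₁ = ι a ⊕ ι q ⊛ ι b ⊛ E₁
      c₂ = ι q ⊛ ι b ⊛ Fₐ
      Kt = ι a ⊛ Fₐ ⊕ ι a ⊛ E ⊕ ι b ⊛ Fₐ ⊛ G ⊕ ι b ⊛ Fₐ ⊛ E
      Ψ : Series → Series
      Ψ Y = c₁ ⊛ Y ⊕ c₂ ⊛ σ q Y
      Ψ-causal : Causal Ψ
      Ψ-causal N Y≈Y′ = ⊕-below N (⊛-below N (λ _ _ → refl) Y≈Y′) (⊛-below N (λ _ _ → refl) (σ-below q N Y≈Y′))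
      Kt-left Kt-right : Series
      Kt-left  = ι a ⊛ (ι 1# ⊕ z ⊛ Lh) ⊕ ι a ⊛ E ⊕ ι b ⊛ Fₐ ⊛ (ι 1# ⊕ ι q ⊛ z ⊛ ((ι a ⊕ ι b ⊛ G₂) ⊛ G)) ⊕ ι b ⊛ Fₐ ⊛ E
      Kt-right = ι a ⊛ Fₐ ⊕ ι a ⊛ (ι 1# ⊕ z ⊛ (c₁ ⊛ E)) ⊕ ι b ⊛ Fₐ ⊛ G ⊕ ι b ⊛ Fₐ ⊛ (ι 1# ⊕ z ⊛ (c₁ ⊛ E))
      Kt≋left : Kt ≋ Kt-left
      Kt≋left = ⊕-cong (⊕-cong (⊕-cong (⊛-cong ≋-refl (F-equation a b)) ≋-refl) (⊛-cong ≋-refl (σ-F-equation a b))) ≋-refl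
      Kt≋right : Kt ≋ Kt-right
      Kt≋right = ⊕-cong (⊕-cong (⊕-cong ≋-refl (⊛-cong ≋-refl (F-equation-qb a b))) ≋-refl) (⊛-cong ≋-refl (F-equation-qb a b))
      ΨLh : Ψ Lh ≋ c₁ ⊛ Lh ⊕ c₂ ⊛ ((ι a ⊕ ι b ⊛ G₂) ⊛ G)
      ΨLh = ⊕-cong ≋-refl (⊛-cong ≋-refl (σ-affine q a b Fₐ G))
      ΨRh : Ψ Rh ≋ c₁ ⊛ Rh ⊕ c₂ ⊛ ((ι a ⊕ ι b ⊛ G) ⊛ E₁)
      ΨRh = ⊕-cong ≋-refl (⊛-cong ≋-refl (σ-affine q a b E Fₐ))
      cross : Lh ⊕ z ⊛ Ψ Rh ≋ Rh ⊕ z ⊛ Ψ Lh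
      cross n = +-cancelʳ (Kt n) _ _ (begin
        (Lh ⊕ z ⊛ Ψ Rh) n + Kt n
          ≈⟨ +-cong (+-congˡ (⊛-cong ≋-refl ΨRh n)) (Kt≋left n) ⟩
        (Lh ⊕ z ⊛ (c₁ ⊛ Rh ⊕ c₂ ⊛ ((ι a ⊕ ι b ⊛ G) ⊛ E₁))) n + Kt-left n
          ≈⟨ solveₛ 10 (λ F G G₂ E E₁ z a b q one →
               (a :⊕ b :⊛ G) :⊛ F :⊕ z :⊛ ((a :⊕ q :⊛ b :⊛ E₁) :⊛ ((a :⊕ b :⊛ F) :⊛ E) :⊕ (q :⊛ b :⊛ F) :⊛ ((a :⊕ b :⊛ G) :⊛ E₁))
                 :⊕ (a :⊛ (one :⊕ z :⊛ ((a :⊕ b :⊛ G) :⊛ F)) :⊕ a :⊛ E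
                     :⊕ b :⊛ F :⊛ (one :⊕ q :⊛ z :⊛ ((a :⊕ b :⊛ G₂) :⊛ G)) :⊕ b :⊛ F :⊛ E)
               :≋ (a :⊕ b :⊛ F) :⊛ E :⊕ z :⊛ ((a :⊕ q :⊛ b :⊛ E₁) :⊛ ((a :⊕ b :⊛ G) :⊛ F) :⊕ (q :⊛ b :⊛ F) :⊛ ((a :⊕ b :⊛ G₂) :⊛ G))
                 :⊕ (a :⊛ F :⊕ a :⊛ (one :⊕ z :⊛ ((a :⊕ q :⊛ b :⊛ E₁) :⊛ E)) :⊕ b :⊛ F :⊛ G
                     :⊕ b :⊛ F :⊛ (one :⊕ z :⊛ ((a :⊕ q :⊛ b :⊛ E₁) :⊛ E))))
               ≋-refl Fₐ G G₂ E E₁ z (ι a) (ι b) (ι q) (ι 1#) n ⟩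
        (Rh ⊕ z ⊛ (c₁ ⊛ Lh ⊕ c₂ ⊛ ((ι a ⊕ ι b ⊛ G₂) ⊛ G))) n + Kt-right n
          ≈⟨ +-cong (+-congˡ (⊛-cong ≋-refl ΨLh n)) (Kt≋right n) ⟨
        (Rh ⊕ z ⊛ Ψ Lh) n + Kt n ∎)

    tail-F-equation : ∀ a b → tail (F a b) ≋ ι (a + b) ⊕ z ⊛ ((ι (a + b) ⊕ ι (q * b) ⊛ σ q (F a (q * b))) ⊛ tail (F a b))
    tail-F-equation a b = ≋-trans tail≋Rh (≋-trans Rh-equation (⊕-cong ≋-refl (⊛-cong ≋-refl (⊛-cong ≋-refl (≋-sym tail≋Rh)))))
      where
      open Solver Series-semiring using () renaming (solve to solveₛ; _:+_ to _:⊕_; _:*_ to _:⊛_; _:=_ to _:≋_; con to conₛ)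
      Fₐ E E₁ Rh h : Series
      Fₐ = F a b
      E  = F a (q * b)
      E₁ = σ q E
      Rh = (ι a ⊕ ι b ⊛ Fₐ) ⊛ E
      h  = ι (a + b) ⊕ ι (q * b) ⊛ E₁
      tail≋Rh : tail Fₐ ≋ Rh
      tail≋Rh = ≋-trans (F-tail a b) (F-factorisation a b)
      F≋ : Fₐ ≋ ι 1# ⊕ z ⊛ Rh
      F≋ = ≋-trans (head-tail Fₐ) (⊕-cong ≋-refl (⊛-cong ≋-refl tail≋Rh))
      constants : ι a ⊕ ι b ⊕ z ⊛ ((ι a ⊕ ι b ⊕ ι q ⊛ ι b ⊛ E₁) ⊛ Rh) ≋ ι (a + b) ⊕ z ⊛ (h ⊛ Rh)
      constants = ⊕-cong (≋-sym (ι-+ a b)) (⊛-cong ≋-refl (⊛-cong (⊕-cong (≋-sym (ι-+ a b)) (⊛-cong (≋-sym (ι-* q b)) ≋-refl)) ≋-refl))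
      Rh-equation : Rh ≋ ι (a + b) ⊕ z ⊛ (h ⊛ Rh)
      Rh-equation n = +-cancelʳ ((Rh ⊕ ι b ⊛ Fₐ) n) _ _ (begin
        Rh n + (Rh ⊕ ι b ⊛ Fₐ) n
          ≈⟨ +-congˡ (+-cong (⊛-cong ≋-refl (F-equation-qb a b) n) (⊛-cong ≋-refl F≋ n)) ⟩
        Rh n + (((ι a ⊕ ι b ⊛ Fₐ) ⊛ (ι 1# ⊕ z ⊛ ((ι a ⊕ ι q ⊛ ι b ⊛ E₁) ⊛ E))) n + (ι b ⊛ (ι 1# ⊕ z ⊛ Rh)) n)
          ≈⟨ solveₛ 7 (λ F E E₁ z a b q →
               (a :⊕ b :⊛ F) :⊛ E
                 :⊕ ((a :⊕ b :⊛ F) :⊛ (conₛ 1 :⊕ z :⊛ ((a :⊕ q :⊛ b :⊛ E₁) :⊛ E)) :⊕ b :⊛ (conₛ 1 :⊕ z :⊛ ((a :⊕ b :⊛ F) :⊛ E)))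
               :≋ (a :⊕ b :⊕ z :⊛ ((a :⊕ b :⊕ q :⊛ b :⊛ E₁) :⊛ ((a :⊕ b :⊛ F) :⊛ E))) :⊕ ((a :⊕ b :⊛ F) :⊛ E :⊕ b :⊛ F))
               ≋-refl Fₐ E E₁ z (ι a) (ι b) (ι q) n ⟩
        (ι a ⊕ ι b ⊕ z ⊛ ((ι a ⊕ ι b ⊕ ι q ⊛ ι b ⊛ E₁) ⊛ Rh)) n + (Rh ⊕ ι b ⊛ Fₐ) n
          ≈⟨ +-congʳ (constants n) ⟩
        (ι (a + b) ⊕ z ⊛ (h ⊛ Rh)) n + (Rh ⊕ ι b ⊛ Fₐ) n ∎)

    -- Closed forms, indexed by the order N of the Hankel matrix (the theorem is about order n + 1).

    P : ℕ → Carrier → Carrier → Carrier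
    P n a b = prodN n (λ k → pow (a + pow q k * b) (n ∸ k))

    Δ₀ Δ₁ : ℕ → Carrier → Carrier → Carrier
    Δ₀ zero    a b = 1#
    Δ₀ (suc n) a b = pow q (tri n *ℕ n) * pow b (tri n) * P n a b
    Δ₁ zero    a b = 1#
    Δ₁ (suc n) a b = pow q (tri n *ℕ suc n) * pow b (tri n) * P (suc n) a b

    P-suc : ∀ n a b → P (suc n) a b ≈ pow (a + b) (suc n) * P n a (q * b)
    P-suc n a b = trans (prodN-head n _) (*-cong (pow-cong (suc n) (+-congˡ (*-identityˡ b)))
      (prodN-cong n (λ k _ → pow-cong (n ∸ k) (+-congˡ (solve 3 (λ q p b → q :* p :* b := p :* (q :* b)) refl q (pow q k) b)))))

    P-scale : ∀ n x a b → P n (x * a) (x * b) ≈ pow x (tri n) * P n a b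
    P-scale n x a b = begin
      P n (x * a) (x * b)                                                   ≈⟨ prodN-cong n (λ k _ →
                                                                                 trans (pow-cong (n ∸ k) (factor {k})) (pow-* x (a + pow q k * b) (n ∸ k))) ⟩
      prodN n (λ k → pow x (n ∸ k) * pow (a + pow q k * b) (n ∸ k))         ≈⟨ prodN-* n _ _ ⟩
      prodN n (λ k → pow x (n ∸ k)) * P n a b                               ≈⟨ *-congʳ (prodN-pow-triangular x n) ⟩
      pow x (tri n) * P n a b                                               ∎
      where
      factor : ∀ {k} → x * a + pow q k * (x * b) ≈ x * (a + pow q k * b)
      factor {k} = solve 4 (λ x a p b → x :* a :+ p :* (x :* b) := x :* (a :+ p :* b)) refl x a (pow q k) b

    Δ₀-suc : ∀ n a b → Δ₀ (suc n) a b ≈ pow b n * Δ₁ n (q * a) (q * b)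
    Δ₀-suc zero    a b = *-identityʳ _
    Δ₀-suc (suc m) a b = begin
      pow q (T′ *ℕ suc m) * pow b T′ * P (suc m) a b
        ≈⟨ *-congʳ (*-cong (trans (reflexive (≡.cong (pow q) (tri-exponent₀ m)))
                                  (trans (pow-+ q (T *ℕ suc m) (T +ℕ T′)) (*-congˡ (pow-+ q T T′))))
                           (trans (reflexive (≡.cong (pow b) (tri-suc m))) (pow-+ b (suc m) T))) ⟩
      pow q (T *ℕ suc m) * (pow q T * pow q T′) * (pow b (suc m) * pow b T) * P (suc m) a b
        ≈⟨ solve 6 (λ q₁ q₂ q₃ b₁ b₂ p → q₁ :* (q₂ :* q₃) :* (b₁ :* b₂) :* p := b₁ :* (q₁ :* (q₂ :* b₂) :* (q₃ :* p))) refl _ _ _ _ _ _ ⟩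
      pow b (suc m) * (pow q (T *ℕ suc m) * (pow q T * pow b T) * (pow q T′ * P (suc m) a b))
        ≈⟨ *-congˡ (*-cong (*-congˡ (pow-* q b T)) (P-scale (suc m) q a b)) ⟨
      pow b (suc m) * Δ₁ (suc m) (q * a) (q * b) ∎
      where
      T T′ : ℕ
      T  = tri m
      T′ = tri (suc m)

    Δ₁-suc : ∀ n a b → Δ₁ (suc n) a b ≈ (a + b) * pow ((a + b) * (q * b)) n * Δ₁ n (q * a) (q * (q * b))
    Δ₁-suc zero    a b =
      solve 2 (λ a b → con 1 :* con 1 :* (con 1 :* ((a :+ con 1 :* b) :* con 1)) := (a :+ b) :* con 1 :* con 1) refl a b
    Δ₁-suc (suc m) a b = begin
      pow q (T′ *ℕ suc (suc m)) * pow b T′ * P (suc (suc m)) a b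
        ≈⟨ *-cong (*-cong q-exponent b-exponent) (P-suc (suc m) a b) ⟩
      pow q (suc m) * (pow q (T *ℕ suc m) * (pow q T * (pow q T * pow q T′))) * (pow b (suc m) * pow b T)
        * ((a + b) * pow (a + b) (suc m) * P (suc m) a (q * b))
        ≈⟨ solve 9 (λ q₁ q₂ q₃ q₄ b₁ b₂ s s₁ p →
              q₁ :* (q₂ :* (q₃ :* (q₃ :* q₄))) :* (b₁ :* b₂) :* (s :* s₁ :* p)
              := s :* (s₁ :* (q₁ :* b₁)) :* (q₂ :* (q₃ :* (q₃ :* b₂)) :* (q₄ :* p))) refl _ _ _ _ _ _ _ _ _ ⟩
      (a + b) * (pow (a + b) (suc m) * (pow q (suc m) * pow b (suc m)))
        * (pow q (T *ℕ suc m) * (pow q T * (pow q T * pow b T)) * (pow q T′ * P (suc m) a (q * b)))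
        ≈⟨ *-cong (*-congˡ (trans (pow-* _ _ (suc m)) (*-congˡ (pow-* q b (suc m)))))
                  (*-cong (*-congˡ (trans (pow-* q _ T) (*-congˡ (pow-* q b T)))) (P-scale (suc m) q a (q * b))) ⟨
      (a + b) * pow ((a + b) * (q * b)) (suc m) * Δ₁ (suc m) (q * a) (q * (q * b)) ∎
      where
      T T′ : ℕ
      T  = tri m
      T′ = tri (suc m)
      q-exponent : pow q (T′ *ℕ suc (suc m)) ≈ pow q (suc m) * (pow q (T *ℕ suc m) * (pow q T * (pow q T * pow q T′)))
      q-exponent = trans (reflexive (≡.cong (pow q) (tri-exponent₁ m)))
        (trans (pow-+ q (suc m) _) (*-congˡ (trans (pow-+ q (T *ℕ suc m) _)
                                   (*-congˡ (trans (pow-+ q T (T +ℕ T′)) (*-congˡ (pow-+ q T T′)))))))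
      b-exponent : pow b T′ ≈ pow b (suc m) * pow b T
      b-exponent = trans (reflexive (≡.cong (pow b) (tri-suc m))) (pow-+ b (suc m) T)

    det-hankel-tail : ∀ n a b (L : MatrixN) → Lower L → detN n (L ·[ n ] hankel (tail (F a b))) ≈ diagProd n L * Δ₁ n a b
    det-hankel-tail zero    a b L _       = sym (*-identityʳ 1#)
    det-hankel-tail (suc n) a b L L-lower = begin
      detN (suc n) (L ·[ suc n ] hankel (tail (F a b)))
        ≈⟨ hankel-reduction n (tail (F a b)) (ι (a + b) ⊕ ι (q * b) ⊛ σ q (F a (q * b))) (F (q * a) (q * (q * b)))
                            L L-lower (equation-tail (tail-F-equation a b)) (equation-head (tail-F-equation a b)) tail-h
                            (det-hankel-tail n (q * a) (q * (q * b))) ⟩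
      diagProd (suc n) L * ((a + b) * pow ((a + b) * (q * b)) n * Δ₁ n (q * a) (q * (q * b)))
        ≈⟨ *-congˡ (Δ₁-suc n a b) ⟨
      diagProd (suc n) L * Δ₁ (suc n) a b ∎
      where
      tail-h : ∀ m → tail (ι (a + b) ⊕ ι (q * b) ⊛ σ q (F a (q * b))) m ≈ q * b * tail (F (q * a) (q * (q * b))) m
      tail-h m = trans (tail-affine (a + b) (q * b) _ m) (*-congˡ (σ-F a (q * b) (suc m)))

    det-hankel : ∀ n a b (L : MatrixN) → Lower L → detN (suc n) (L ·[ suc n ] hankel (F a b)) ≈ diagProd (suc n) L * Δ₀ (suc n) a b
    det-hankel n a b L L-lower = begin
      detN (suc n) (L ·[ suc n ] hankel (F a b))
        ≈⟨ hankel-reduction n (F a b) (ι a ⊕ ι b ⊛ σ q (F a b)) (F (q * a) (q * b))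
                            L L-lower (F-tail a b) refl tail-h (det-hankel-tail n (q * a) (q * b)) ⟩
      diagProd (suc n) L * (1# * pow (1# * b) n * Δ₁ n (q * a) (q * b))
        ≈⟨ *-congˡ (*-congʳ (trans (*-identityˡ _) (pow-cong n (*-identityˡ b)))) ⟩
      diagProd (suc n) L * (pow b n * Δ₁ n (q * a) (q * b))
        ≈⟨ *-congˡ (Δ₀-suc n a b) ⟨
      diagProd (suc n) L * Δ₀ (suc n) a b ∎
      where
      tail-h : ∀ m → tail (ι a ⊕ ι b ⊛ σ q (F a b)) m ≈ b * tail (F (q * a) (q * b)) m
      tail-h m = trans (tail-affine a b _ m) (*-congˡ (σ-F a b (suc m)))

    hankel-det : ∀ n a b → detN (suc n) (hankel (F a b)) ≈ Δ₀ (suc n) a b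
    hankel-det n a b = detN-via-identity (suc n) (hankel (F a b)) (Δ₀ (suc n) a b) (det-hankel n a b)

    shifted-hankel-det : ∀ n a b → detN n (hankel (tail (F a b))) ≈ Δ₁ n a b
    shifted-hankel-det n a b = detN-via-identity n (hankel (tail (F a b))) (Δ₁ n a b) (det-hankel-tail n a b)

open TriangularNumbers using (n²[n+1]/2≡tri*n; n[n+1]²/2≡tri*[n+1])

mainTheorem1 : ∀ {c ℓ : Level} (R : CommutativeRing c ℓ) →
  let open CommutativeRing R
      open Narayana R renaming (C to Cₙ)
  in ∀ (a b q : Carrier) (n : ℕ) →
    (det (suc n) (λ i j → Cₙ a b q (toℕ i +ℕ toℕ j))
      ≈ pow q ((n *ℕ n *ℕ suc n) / 2) * pow b (suc n C 2)
        * prodN n (λ k → pow (a + pow q k * b) (n Data.Nat.∸ k)))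
    ×
    (det (suc n) (λ i j → Cₙ a b q (suc (toℕ i +ℕ toℕ j)))
      ≈ pow q ((n *ℕ suc n *ℕ suc n) / 2) * pow b (suc n C 2)
        * prodN (suc n) (λ k → pow (a + pow q k * b) (suc n Data.Nat.∸ k)))
mainTheorem1 R a b q n rewrite n²[n+1]/2≡tri*n n | n[n+1]²/2≡tri*[n+1] n =
  hankel-det q n a b , shifted-hankel-det q (suc n) a b
  where open QNarayanaHankel R
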